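{- Let $t\geq2$ and $0\leq z\leq t-1$ be integers. The Littlewood decomposition $\Phi_t$ maps each partition $\lambda\in\mathrm{BG}_{z,t}$ to $(\omega,\nu^{(0)},\dots,\nu^{(t-1)})=(\omega,\underline\nu)$ such that: (BG1) $\omega$ is a $t$-core belonging to $\mathcal P_z$, and $\nu^{(0)},\dots,\nu^{(t-1)}$ are partitions; (BG2) for all $r\in\{z,\dots,t-1\}$, $\nu^{(r)}=(\nu^{(t+z-r-1)})'$; (BG$'$2) $\nu^{(0)}=\dots=\nu^{(z-1)}=\emptyset$, and if $t+z-1$ is even, $\nu^{((t+z-1)/2)}=\emptyset$; (BG3) $|\lambda|=|\omega|+2t\sum_{r=z}^{\lfloor (t+z-2)/2\rfloor}|\nu^{(r)}|$; (BG4) $\mathcal H_t(\lambda)=t\,\mathcal H(\underline\nu)$.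
   Context: For a box of the Ferrers diagram of $\lambda$, the hook length is $1$ plus the number of boxes strictly right of it in its row plus the number strictly below it in its column; $\mathcal H(\lambda)$ is the multiset of hook lengths, $\mathcal H_t(\lambda)$ the sub-multiset of those divisible by $t$; $\mathcal H(\underline\nu)=\bigcup_{i=0}^{t-1}\mathcal H(\nu^{(i)})$ (multiset union) and $tS=\{ts:s\in S\}$. $\lambda'$ is the conjugate partition. A $t$-core is a partition with no hook length divisible by $t$. Frobenius notation: $\lambda=\begin{pmatrix}\alpha_1&\cdots&\alpha_d\\ \beta_1&\cdots&\beta_d\end{pmatrix}$ with $d=\max\{s:\lambda_s\ge s\}$, $\alpha_i=\lambda_i-i$, $\beta_i=\lambda'_i-i$. $\mathcal P_z$ is the set of partitions with Frobenius notation $\begin{pmatrix}a_1+z&\cdots&a_d+z\\ a_1&\cdots&a_d\end{pmatrix}$; $\mathrm{BG}_{z,t}$ is the set of $\lambda\in\mathcal P_z$ with $(a_j+k)/t\notin\mathbb N$ and $(2a_j+z+1)/t\notin2\mathbb N+1$ for all $1\le j\le d$, $1\le k\le z$. Boundary word: $s(\lambda)=(c_i)_{i\in\mathbb Z}$ with $c_i=0$ if $i\in\{\lambda_j-j:j\ge1\}$ ($\lambda_j=0$ for $j>\ell(\lambda)$) and $c_i=1$ otherwise; any $0/1$ sequence with only $0$'s far left and only $1$'s far right encodes, after the unique index shift making $\#\{i\le-1:c_i=1\}=\#\{i\ge0:c_i=0\}$, a unique partition. Littlewood decomposition: $\Phi_t(\lambda)=(\omega,\nu^{(0)},\dots,\nu^{(t-1)})$,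 where $\nu^{(k)}$ is the partition encoded (up to shift) by $(c_{ti+k})_{i\in\mathbb Z}$ and $\omega$, the $t$-core of $\lambda$, is encoded by the word obtained from $s(\lambda)$ by rearranging, within each residue class of positions mod $t$, the letters so that all $0$'s precede all $1$'s. -}

module Defs where

open import Data.Bool using (Bool; true; false; not; _∨_)
open import Data.Nat using (ℕ; zero; suc; _+_; _*_; _∸_; _≤_; _<_; _≤?_; _<ᵇ_; _≡ᵇ_; ⌊_/2⌋)
open import Data.Nat.Divisibility using (_∣_)
open import Data.List using (List; []; _∷_; length; map; filter; concatMap; upTo; reverse)
open import Data.Nat.ListAction using (sum)
open import Data.Bool.ListAction using (any)
open import Data.Product using (_×_; ∃)
open import Relation.Nullary using (¬_)
open import Relation.Binary.PropositionalEquality using (_≡_)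

data Decreasing : List ℕ → Set where
  dec-[]  : Decreasing []
  dec-one : ∀ x → Decreasing (x ∷ [])
  dec-∷   : ∀ x y xs → y ≤ x → Decreasing (y ∷ xs) → Decreasing (x ∷ y ∷ xs)

data AllPositive : List ℕ → Set where
  pos-[] : AllPositive []
  pos-∷  : ∀ {x xs} → 1 ≤ x → AllPositive xs → AllPositive (x ∷ xs)

IsPartition : List ℕ → Set
IsPartition la = Decreasing la × AllPositive la

-- the i-th part, 1-indexed; 0 beyond the length
part : List ℕ → ℕ → ℕ
part []       _             = 0
part (x ∷ xs) zero          = 0
part (x ∷ xs) (suc zero)    = x
part (x ∷ xs) (suc (suc i)) = part xs (suc i)

range : ℕ → ℕ → List ℕ
range a b = map (a +_) (upTo (b ∸ a))

size : List ℕ → ℕ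
size = sum

conj : List ℕ → List ℕ
conj la = map (λ i → length (filter (λ x → i ≤? x) la)) (range 1 (suc (part la 1)))

hooks : List ℕ → List ℕ
hooks la = concatMap (λ i → map (λ j → (part la i ∸ j) + (part (conj la) j ∸ i) + 1)
                                (range 1 (suc (part la i))))
                     (range 1 (suc (length la)))

data NoneDivisible (t : ℕ) : List ℕ → Set where
  nd-[] : NoneDivisible t []
  nd-∷  : ∀ {h hs} → ¬ (t ∣ h) → NoneDivisible t hs → NoneDivisible t (h ∷ hs)

IsTCore : ℕ → List ℕ → Set
IsTCore t la = NoneDivisible t (hooks la)

durfee : List ℕ → ℕ
durfee la = length (filter (λ s → s ≤? part la s) (range 1 (suc (length la))))

frobα frobβ : List ℕ → ℕ → ℕ
frobα la i = part la i ∸ i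
frobβ la i = part (conj la) i ∸ i

-- λ ∈ P_z : α_i = a_i + z, β_i = a_i for all 1 ≤ i ≤ d (i.e. α_i = β_i + z)
InP : ℕ → List ℕ → Set
InP z la = ∀ i → 1 ≤ i → i ≤ durfee la → frobα la i ≡ frobβ la i + z

-- λ ∈ BG_{z,t}  (with a_j = β_j)
InBG : ℕ → ℕ → List ℕ → Set
InBG z t la = IsPartition la × InP z la ×
  (∀ j → 1 ≤ j → j ≤ durfee la →
     (∀ k → 1 ≤ k → k ≤ z → ¬ (t ∣ (frobβ la j + k)))
     × ¬ (∃ λ m → 2 * frobβ la j + z + 1 ≡ t * (2 * m + 1)))

-- Letters: false = 0, true = 1.  Positions are shifted: p = i + N with
-- N = t * M, M = ℓ(λ) + λ_1 + 1, so residues mod t are preserved; all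
-- positions p < N - ℓ carry 0, all p ≥ N + λ_1 carry 1, and the window
-- [0, 2N) contains all non-trivial letters.

windowM : List ℕ → ℕ
windowM la = length la + part la 1 + 1

-- letter c_{p - N} of s(λ)
letter : ℕ → List ℕ → ℕ → Bool
letter t la p =
  let N = t * windowM la in
  not ((p <ᵇ N ∸ length la) ∨
       any (λ j → p ≡ᵇ (part la j + N) ∸ j) (range 1 (suc (length la))))

-- decoding a finite window (only 0's to its left, only 1's to its right):
-- each letter 0 gives the part "number of 1's to its left"
decodeAux : ℕ → List Bool → List ℕ
decodeAux c []            = []
decodeAux c (true ∷ w)    = decodeAux (suc c) w
decodeAux c (false ∷ w)   = c ∷ decodeAux c w

decode : List Bool → List ℕ
decode w = reverse (filter (λ x → 1 ≤? x) (decodeAux 0 w))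

classWord : ℕ → List ℕ → ℕ → List Bool
classWord t la k = map (λ q → letter t la (t * q + k)) (upTo (2 * windowM la))

quotientPart : ℕ → List ℕ → ℕ → List ℕ
quotientPart t la k = decode (classWord t la k)

zerosIn : ℕ → List ℕ → ℕ → ℕ
zerosIn t la k = length (filter (λ b → b Data.Bool.≟ false) (classWord t la k))

-- ω: in each residue class, move all 0's before all 1's
tcore : ℕ → List ℕ → List ℕ
tcore t la = decode (concatMap (λ q → map (λ k → not (q <ᵇ zerosIn t la k)) (upTo t))
                               (upTo (2 * windowM la)))

{-# OPTIONS --safe #-}
module Submission where

-- Work with the boundary word of λ with its origin moved to c = t·M (M = ℓ(λ) + λ₁ + 1, as in
-- Defs.letter), so that it has exactly c letters 0. Any 0/1-word determines a partition: every letter 0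
-- contributes a part equal to the number of letters 1 before it, and the hook lengths are the
-- distances from a letter 1 to a later letter 0. A hook divisible by t thus joins two letters
-- of one residue class mod t, which gives (BG4); summing the positions of the letters 0 class
-- by class gives |λ| = |ω| + t Σ |ν⁽ᵏ⁾|.
--
-- The letters 0 right of position c are the c + α_i and the letters 1 left of it are the
-- c − 1 − β_i, so λ ∈ P_z makes the word symmetric: from c on it begins with z letters 1, and
-- p ↦ 2c + z − 1 − p exchanges 0 and 1 elsewhere. This reflection maps class r onto class
-- t + z − 1 − r reversed and complemented, whence (BG2); the core word inherits the symmetry,
-- so ω ∈ P_z. The conditions defining BG_{z,t} say that no α_i or β_i lies in a class r < z
-- or in the middle class, so these classes are sorted and their quotients empty (BG'2), and
-- (BG3) follows by pairing the remaining classes.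

open import Defs
open import Data.Bool using (Bool; true; false; not; _∧_; _∨_; T; if_then_else_) renaming (_≟_ to _≟ᵇ_)
open import Data.Bool.Properties using (not-involutive; ∧-identityʳ; ∧-zeroʳ; ∨-identityʳ; ∨-zeroʳ)
open import Data.Bool.ListAction using (any; or)
open import Data.Nat using (ℕ; zero; suc; _+_; _*_; _∸_; _≤_; _<_; _≤?_; _<?_; _<ᵇ_; _≡ᵇ_; _≤ᵇ_; z≤n; s≤s; z<s; NonZero; >-nonZero; >-nonZero⁻¹; _/_; _%_; ⌊_/2⌋)
open import Data.Nat.Properties
open import Data.Nat.DivMod
open import Data.Nat.Divisibility using (_∣_; _∣?_; divides; ∣⇒≤; ∣m+n∣m⇒∣n; ∣m∣n⇒∣m+n; ∣-refl)
open import Data.Nat.ListAction using (sum)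
open import Data.Nat.Tactic.RingSolver
open import Data.List using (List; []; _∷_; _++_; [_]; length; map; filter; concatMap; concat; upTo; downFrom; reverse; applyUpTo)
open import Data.List.Properties using (map-upTo; applyUpTo-∷ʳ; map-++; filter-++; reverse-++; map-cong; ++-assoc; map-∘; map-id; concatMap-map; concatMap-++; map-concatMap; ++-identityʳ; length-++; length-map; length-filter; filter-accept; filter-reject)
open import Data.List.Relation.Unary.All using (All; []; _∷_)
import Data.List.Relation.Unary.All as All
import Data.List.Relation.Unary.All.Properties as AllP
open import Data.List.Relation.Binary.Permutation.Propositional using (_↭_; ↭-refl; ↭-trans; ↭-reflexive; module PermutationReasoning)
open import Data.List.Relation.Binary.Permutation.Propositional.Properties using (↭-empty-inv; ++⁺ˡ; ++⁺ʳ; ++⁺) renaming (++-comm to ↭-++-comm)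
open import Data.Product using (Σ; _×_; _,_; proj₁; proj₂)
open import Data.Sum using (_⊎_; inj₁; inj₂; [_,_]′) renaming (map to ⊎-map)
open import Data.Empty using (⊥; ⊥-elim)
open import Relation.Nullary using (¬_; yes; no)
open import Relation.Binary.Definitions using (tri<; tri≈; tri>)
open import Relation.Binary.PropositionalEquality hiding ([_])

true≢false : true ≢ false
true≢false ()

T⇒≡true : ∀ {b} → T b → b ≡ true
T⇒≡true {true} _ = refl

≡true⇒T : ∀ {b} → b ≡ true → T b
≡true⇒T refl = _

¬T⇒≡false : ∀ {b} → ¬ T b → b ≡ false
¬T⇒≡false {true} ¬t = ⊥-elim (¬t _)
¬T⇒≡false {false} _ = refl

not-∨-∨ : ∀ a b c → not (a ∨ (b ∨ c)) ≡ not (a ∨ c) ∧ not b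
not-∨-∨ true b c = refl
not-∨-∨ false true c = sym (∧-zeroʳ _)
not-∨-∨ false false c = sym (∧-identityʳ _)

≤ᵇ-true : ∀ {m n} → m ≤ n → (m ≤ᵇ n) ≡ true
≤ᵇ-true m≤n = T⇒≡true (≤⇒≤ᵇ m≤n)

≤ᵇ-false : ∀ {m n} → n < m → (m ≤ᵇ n) ≡ false
≤ᵇ-false {m} {n} n<m = ¬T⇒≡false (λ t → <⇒≱ n<m (≤ᵇ⇒≤ m n t))

≤ᵇ-true⁻¹ : ∀ {m n} → (m ≤ᵇ n) ≡ true → m ≤ n
≤ᵇ-true⁻¹ {m} {n} e = ≤ᵇ⇒≤ m n (≡true⇒T e)

<ᵇ-true : ∀ {m n} → m < n → (m <ᵇ n) ≡ true
<ᵇ-true m<n = T⇒≡true (<⇒<ᵇ m<n)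

<ᵇ-false : ∀ {m n} → n ≤ m → (m <ᵇ n) ≡ false
<ᵇ-false {m} {n} n≤m = ¬T⇒≡false (λ t → ≤⇒≯ n≤m (<ᵇ⇒< m n t))

≡ᵇ-true : ∀ {m n} → m ≡ n → (m ≡ᵇ n) ≡ true
≡ᵇ-true {m} {n} m≡n = T⇒≡true (≡⇒≡ᵇ m n m≡n)

≡ᵇ-false : ∀ {m n} → m ≢ n → (m ≡ᵇ n) ≡ false
≡ᵇ-false {m} {n} m≢n = ¬T⇒≡false (λ t → m≢n (≡ᵇ⇒≡ m n t))

≡ᵇ-true⁻¹ : ∀ {m n} → (m ≡ᵇ n) ≡ true → m ≡ n
≡ᵇ-true⁻¹ {m} {n} e = ≡ᵇ⇒≡ m n (≡true⇒T e)

bit : Bool → ℕ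
bit true = 1
bit false = 0

bit-not : ∀ b → bit b + bit (not b) ≡ 1
bit-not true = refl
bit-not false = refl

bit≤1 : ∀ b → bit b ≤ 1
bit≤1 true = ≤-refl
bit≤1 false = z≤n

Σ< : ℕ → (ℕ → ℕ) → ℕ
Σ< zero g = 0
Σ< (suc n) g = Σ< n g + g n

Σ<-cong : ∀ n {g h : ℕ → ℕ} → (∀ x → x < n → g x ≡ h x) → Σ< n g ≡ Σ< n h
Σ<-cong zero e = refl
Σ<-cong (suc n) e = cong₂ _+_ (Σ<-cong n (λ x x<n → e x (m<n⇒m<1+n x<n))) (e n ≤-refl)

Σ<-+ : ∀ n (g h : ℕ → ℕ) → Σ< n (λ x → g x + h x) ≡ Σ< n g + Σ< n h
Σ<-+ zero g h = refl
Σ<-+ (suc n) g h = trans (cong (_+ (g n + h n)) (Σ<-+ n g h)) (interchange (Σ< n g) (Σ< n h) (g n) (h n))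
  where
  interchange : ∀ a b c d → a + b + (c + d) ≡ a + c + (b + d)
  interchange = solve-∀

Σ<-const : ∀ n c → Σ< n (λ _ → c) ≡ n * c
Σ<-const zero c = refl
Σ<-const (suc n) c = trans (cong (_+ c) (Σ<-const n c)) (+-comm (n * c) c)

Σ<-zero : ∀ n {g : ℕ → ℕ} → (∀ x → x < n → g x ≡ 0) → Σ< n g ≡ 0
Σ<-zero n e = trans (Σ<-cong n e) (trans (Σ<-const n 0) (*-zeroʳ n))

Σ<-split : ∀ n m (g : ℕ → ℕ) → Σ< (n + m) g ≡ Σ< n g + Σ< m (λ i → g (n + i))
Σ<-split n zero g = trans (cong (λ k → Σ< k g) (+-identityʳ n)) (sym (+-identityʳ _))
Σ<-split n (suc m) g = trans (cong (λ k → Σ< k g) (+-suc n m)) (trans (cong (_+ g (n + m)) (Σ<-split n m g)) (+-assoc (Σ< n g) _ _))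

Σ<-cons : ∀ n (g : ℕ → ℕ) → Σ< (suc n) g ≡ g 0 + Σ< n (λ i → g (suc i))
Σ<-cons n g = Σ<-split 1 n g

Σ<-rev : ∀ n (g : ℕ → ℕ) → Σ< n (λ i → g (n ∸ suc i)) ≡ Σ< n g
Σ<-rev zero g = refl
Σ<-rev (suc n) g = trans (Σ<-cons n (λ i → g (suc n ∸ suc i))) (trans (+-comm (g n) _) (cong (_+ g n) (Σ<-rev n g)))

Σ<-* : ∀ n c (g : ℕ → ℕ) → Σ< n (λ i → c * g i) ≡ c * Σ< n g
Σ<-* zero c g = sym (*-zeroʳ c)
Σ<-* (suc n) c g = trans (cong (_+ c * g n) (Σ<-* n c g)) (sym (*-distribˡ-+ c (Σ< n g) (g n)))

Σ<-mono : ∀ n {g h : ℕ → ℕ} → (∀ x → x < n → g x ≤ h x) → Σ< n g ≤ Σ< n h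
Σ<-mono zero e = z≤n
Σ<-mono (suc n) e = +-mono-≤ (Σ<-mono n (λ x x<n → e x (m<n⇒m<1+n x<n))) (e n ≤-refl)

Σ<-blocks : ∀ t K (g : ℕ → ℕ) → Σ< (t * K) g ≡ Σ< K (λ X → Σ< t (λ k → g (t * X + k)))
Σ<-blocks t zero g = cong (λ n → Σ< n g) (*-zeroʳ t)
Σ<-blocks t (suc K) g = trans (cong (λ n → Σ< n g) (trans (*-suc t K) (+-comm t (t * K))))
  (trans (Σ<-split (t * K) t g) (cong (_+ Σ< t (λ k → g (t * K + k))) (Σ<-blocks t K g)))

Σ<-swap : ∀ K t (h : ℕ → ℕ → ℕ) → Σ< K (λ X → Σ< t (λ k → h X k)) ≡ Σ< t (λ k → Σ< K (λ X → h X k))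
Σ<-swap zero t h = sym (Σ<-zero t (λ _ _ → refl))
Σ<-swap (suc K) t h = trans (cong (_+ Σ< t (λ k → h K k)) (Σ<-swap K t h)) (sym (Σ<-+ t (λ k → Σ< K (λ X → h X k)) (λ k → h K k)))

count : ℕ → (ℕ → Bool) → ℕ
count n f = Σ< n (λ x → bit (f x))

count-cong : ∀ n {f g : ℕ → Bool} → (∀ x → x < n → f x ≡ g x) → count n f ≡ count n g
count-cong n e = Σ<-cong n (λ x x<n → cong bit (e x x<n))

count-suc-upFrom : ∀ n a (g : ℕ → Bool) → count (suc n) (λ i → g (a + i)) ≡ bit (g a) + count n (λ i → g (suc a + i))
count-suc-upFrom n a g = trans (Σ<-cons n (λ i → bit (g (a + i)))) (cong₂ _+_ (cong (λ k → bit (g k)) (+-identityʳ a)) (count-cong n (λ i _ → cong g (+-suc a i))))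

count-all : ∀ n {f : ℕ → Bool} → (∀ x → x < n → f x ≡ true) → count n f ≡ n
count-all n e = trans (Σ<-cong n (λ x x<n → cong bit (e x x<n))) (trans (Σ<-const n 1) (*-identityʳ n))

count≤ : ∀ n f → count n f ≤ n
count≤ n f = subst (count n f ≤_) (trans (Σ<-const n 1) (*-identityʳ n)) (Σ<-mono n (λ x _ → bit≤1 (f x)))

count-mono : ∀ {a b} f → a ≤ b → count a f ≤ count b f
count-mono {a} {b} f a≤b = subst (λ k → count a f ≤ count k f) (m+[n∸m]≡n a≤b)
  (subst (count a f ≤_) (sym (Σ<-split a (b ∸ a) (λ x → bit (f x)))) (m≤m+n _ _))

count-<ᵇ : ∀ h p → p ≤ h → count h (λ i → i <ᵇ p) ≡ p
count-<ᵇ h p p≤h = begin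
  count h (_<ᵇ p)                                   ≡⟨ cong (λ n → count n (_<ᵇ p)) (sym (m+[n∸m]≡n p≤h)) ⟩
  count (p + (h ∸ p)) (_<ᵇ p)                       ≡⟨ Σ<-split p (h ∸ p) _ ⟩
  count p (_<ᵇ p) + Σ< (h ∸ p) (λ i → bit (p + i <ᵇ p)) ≡⟨ cong₂ _+_ below above ⟩
  p + 0                                             ≡⟨ +-identityʳ p ⟩
  p                                                 ∎
  where
  open ≡-Reasoning
  below : count p (_<ᵇ p) ≡ p
  below = count-all p (λ _ → <ᵇ-true)
  above : Σ< (h ∸ p) (λ i → bit (p + i <ᵇ p)) ≡ 0
  above = Σ<-zero (h ∸ p) (λ i _ → cong bit (<ᵇ-false (m≤m+n p i)))

map-upTo-suc : ∀ {A : Set} (f : ℕ → A) n → map f (upTo (suc n)) ≡ map f (upTo n) ++ [ f n ]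
map-upTo-suc f n = trans (map-upTo f (suc n)) (trans (sym (applyUpTo-∷ʳ f n)) (cong (_++ [ f n ]) (sym (map-upTo f n))))

map-upTo-+ : ∀ {A : Set} (g : ℕ → A) a b → map g (upTo (a + b)) ≡ map g (upTo a) ++ map (λ i → g (a + i)) (upTo b)
map-upTo-+ g a zero = trans (cong (λ k → map g (upTo k)) (+-identityʳ a)) (sym (++-identityʳ _))
map-upTo-+ g a (suc b) = begin
  map g (upTo (a + suc b))                   ≡⟨ cong (λ k → map g (upTo k)) (+-suc a b) ⟩
  map g (upTo (suc (a + b)))                 ≡⟨ map-upTo-suc g (a + b) ⟩
  map g (upTo (a + b)) ++ [ g (a + b) ]      ≡⟨ cong (_++ [ g (a + b) ]) (map-upTo-+ g a b) ⟩
  (map g (upTo a) ++ gs b) ++ [ g (a + b) ]  ≡⟨ ++-assoc (map g (upTo a)) (gs b) _ ⟩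
  map g (upTo a) ++ (gs b ++ [ g (a + b) ])  ≡⟨ cong (map g (upTo a) ++_) (sym (map-upTo-suc (λ i → g (a + i)) b)) ⟩
  map g (upTo a) ++ gs (suc b)               ∎
  where
  open ≡-Reasoning
  gs : ℕ → List _
  gs n = map (λ i → g (a + i)) (upTo n)

map-upTo-cong : ∀ {A : Set} n {f g : ℕ → A} → (∀ i → i < n → f i ≡ g i) → map f (upTo n) ≡ map g (upTo n)
map-upTo-cong zero e = refl
map-upTo-cong (suc n) {f} {g} e = trans (map-upTo-suc f n)
  (trans (cong₂ _++_ (map-upTo-cong n (λ i i<n → e i (m<n⇒m<1+n i<n))) (cong [_] (e n ≤-refl))) (sym (map-upTo-suc g n)))

upTo-suc : ∀ n → upTo (suc n) ≡ upTo n ++ [ n ]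
upTo-suc n = trans (sym (map-id (upTo (suc n)))) (trans (map-upTo-suc (λ x → x) n) (cong (_++ [ n ]) (map-id (upTo n))))

upFrom : ℕ → ℕ → List ℕ
upFrom a zero = []
upFrom a (suc n) = a ∷ upFrom (suc a) n

length-upFrom : ∀ a n → length (upFrom a n) ≡ n
length-upFrom a zero = refl
length-upFrom a (suc n) = cong suc (length-upFrom (suc a) n)

applyUpTo≡upFrom : ∀ a n → applyUpTo (a +_) n ≡ upFrom a n
applyUpTo≡upFrom a zero = refl
applyUpTo≡upFrom a (suc n) = cong₂ _∷_ (+-identityʳ a) (trans (applyUpTo-cong n (+-suc a)) (applyUpTo≡upFrom (suc a) n))
  where
  applyUpTo-cong : ∀ n {f g : ℕ → ℕ} → (∀ x → f x ≡ g x) → applyUpTo f n ≡ applyUpTo g n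
  applyUpTo-cong zero e = refl
  applyUpTo-cong (suc n) e = cong₂ _∷_ (e 0) (applyUpTo-cong n (λ x → e (suc x)))

range≡upFrom : ∀ a b → range a b ≡ upFrom a (b ∸ a)
range≡upFrom a b = trans (map-upTo (a +_) (b ∸ a)) (applyUpTo≡upFrom a (b ∸ a))

upFrom-suc : ∀ a n → upFrom (suc a) n ≡ map suc (upFrom a n)
upFrom-suc a zero = refl
upFrom-suc a (suc n) = cong (suc a ∷_) (upFrom-suc (suc a) n)

upFrom-∷ʳ : ∀ a n → upFrom a (suc n) ≡ upFrom a n ++ [ a + n ]
upFrom-∷ʳ a zero = cong [_] (sym (+-identityʳ a))
upFrom-∷ʳ a (suc n) = cong (a ∷_) (trans (upFrom-∷ʳ (suc a) n) (cong (λ x → upFrom (suc a) n ++ [ x ]) (sym (+-suc a n))))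

map-cong-upFrom : ∀ {A : Set} a n {f g : ℕ → A} → (∀ j → a ≤ j → j < a + n → f j ≡ g j) → map f (upFrom a n) ≡ map g (upFrom a n)
map-cong-upFrom a zero e = refl
map-cong-upFrom a (suc n) e = cong₂ _∷_ (e a ≤-refl (m<m+n a z<s))
  (map-cong-upFrom (suc a) n (λ j a<j j<n → e j (<⇒≤ a<j) (subst (j <_) (sym (+-suc a n)) j<n)))

concatMap-cong-upFrom : ∀ {A : Set} a n {f g : ℕ → List A} → (∀ j → a ≤ j → j < a + n → f j ≡ g j) →
  concatMap f (upFrom a n) ≡ concatMap g (upFrom a n)
concatMap-cong-upFrom a n e = cong concat (map-cong-upFrom a n e)

sum-map-upFrom : ∀ (g : ℕ → ℕ) a n → sum (map g (upFrom a n)) ≡ Σ< n (λ i → g (a + i))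
sum-map-upFrom g a zero = refl
sum-map-upFrom g a (suc n) = trans (cong₂ _+_ (cong g (sym (+-identityʳ a)))
  (trans (sum-map-upFrom g (suc a) n) (Σ<-cong n (λ i _ → cong g (sym (+-suc a i))))))
  (sym (Σ<-cons n (λ i → g (a + i))))

sum-map-range : ∀ (g : ℕ → ℕ) a b → sum (map g (range a b)) ≡ Σ< (b ∸ a) (λ i → g (a + i))
sum-map-range g a b = trans (cong (λ l → sum (map g l)) (range≡upFrom a b)) (sum-map-upFrom g a (b ∸ a))

any≡true⇒∃ : ∀ (h : ℕ → Bool) a n → any h (upFrom a n) ≡ true → Σ ℕ λ j → a ≤ j × j < a + n × h j ≡ true
any≡true⇒∃ h a (suc n) e with h a in eq
... | true = a , ≤-refl , m<m+n a z<s , eq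
... | false with any≡true⇒∃ h (suc a) n e
... | j , a<j , j< , hj = j , <⇒≤ a<j , subst (j <_) (sym (+-suc a n)) j< , hj

∃⇒any≡true : ∀ (h : ℕ → Bool) a n j → a ≤ j → j < a + n → h j ≡ true → any h (upFrom a n) ≡ true
∃⇒any≡true h a zero j a≤j j< hj = ⊥-elim (<⇒≱ j< (subst (_≤ j) (sym (+-identityʳ a)) a≤j))
∃⇒any≡true h a (suc n) j a≤j j< hj with m≤n⇒m<n∨m≡n a≤j
... | inj₂ refl = cong (_∨ or (map h (upFrom (suc a) n))) hj
... | inj₁ a<j = trans (cong (h a ∨_) (∃⇒any≡true h (suc a) n j a<j (subst (j <_) (+-suc a n) j<) hj)) (∨-zeroʳ (h a))

any-cong-upFrom : ∀ a n {f g : ℕ → Bool} → (∀ j → a ≤ j → j < a + n → f j ≡ g j) → any f (upFrom a n) ≡ any g (upFrom a n)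
any-cong-upFrom a n e = cong or (map-cong-upFrom a n e)

any-map : ∀ (f : ℕ → Bool) (h : ℕ → ℕ) xs → any f (map h xs) ≡ any (λ x → f (h x)) xs
any-map f h xs = cong or (sym (map-∘ xs))

-- Partitions, conjugates and hooks

atLeast : List ℕ → ℕ → ℕ
atLeast la j = length (filter (λ x → j ≤? x) la)

atLeast-∷ : ∀ y l j → atLeast (y ∷ l) j ≡ bit (j ≤ᵇ y) + atLeast l j
atLeast-∷ y l j with j ≤ᵇ y
... | true = refl
... | false = refl

atLeast-∷-≤ : ∀ m la j → j ≤ m → atLeast (m ∷ la) j ≡ suc (atLeast la j)
atLeast-∷-≤ m la j le = cong length (filter-accept (λ x → j ≤? x) le)

atLeast-∷-> : ∀ m la j → m < j → atLeast (m ∷ la) j ≡ atLeast la j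
atLeast-∷-> m la j lt = cong length (filter-reject (λ x → j ≤? x) (<⇒≱ lt))

decreasing-∷ : ∀ m l → Decreasing l → part l 1 ≤ m → Decreasing (m ∷ l)
decreasing-∷ m [] d le = dec-one m
decreasing-∷ m (y ∷ l) d le = dec-∷ m y l le d

decreasing-uncons : ∀ {x l} → Decreasing (x ∷ l) → Decreasing l × part l 1 ≤ x
decreasing-uncons (dec-one x) = dec-[] , z≤n
decreasing-uncons (dec-∷ x y xs y≤x d) = d , y≤x

part≤head : ∀ {l} → Decreasing l → ∀ i → part l (suc i) ≤ part l 1
part≤head dec-[] i = z≤n
part≤head (dec-one x) zero = ≤-refl
part≤head (dec-one x) (suc i) = z≤n
part≤head (dec-∷ x y xs y≤x d) zero = ≤-refl
part≤head (dec-∷ x y xs y≤x d) (suc i) = ≤-trans (part≤head d i) y≤x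

part-suc≤part : ∀ {la} → Decreasing la → ∀ i → part la (suc (suc i)) ≤ part la (suc i)
part-suc≤part dec-[] i = z≤n
part-suc≤part (dec-one x) i = z≤n
part-suc≤part (dec-∷ x y xs y≤x d) zero = y≤x
part-suc≤part (dec-∷ x y xs y≤x d) (suc i) = part-suc≤part d i

part-anti : ∀ {la} → Decreasing la → ∀ {i j} → i ≤ j → part la (suc j) ≤ part la (suc i)
part-anti d {j = zero} z≤n = ≤-refl
part-anti d {i} {suc j} i≤1+j with m≤n⇒m<n∨m≡n i≤1+j
... | inj₁ i<1+j = ≤-trans (part-suc≤part d j) (part-anti d (≤-pred i<1+j))
... | inj₂ refl = ≤-refl

part-beyondLength : ∀ l i → length l ≤ i → part l (suc i) ≡ 0
part-beyondLength [] i _ = refl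
part-beyondLength (x ∷ l) (suc i) (s≤s le) = part-beyondLength l i le

allPositive-head≡0 : ∀ {l} → AllPositive l → part l 1 ≡ 0 → l ≡ []
allPositive-head≡0 pos-[] _ = refl
allPositive-head≡0 (pos-∷ {x} (s≤s _) _) ()

atLeast-beyondHead : ∀ {la} → Decreasing la → ∀ j → part la 1 < j → atLeast la j ≡ 0
atLeast-beyondHead dec-[] j lt = refl
atLeast-beyondHead (dec-one x) j lt = atLeast-∷-> x [] j lt
atLeast-beyondHead (dec-∷ x y xs y≤x d) j lt = trans (atLeast-∷-> x (y ∷ xs) j lt) (atLeast-beyondHead d j (≤-<-trans y≤x lt))

atLeast-anti : ∀ l i → atLeast l (suc i) ≤ atLeast l i
atLeast-anti [] i = z≤n
atLeast-anti (y ∷ l) i rewrite atLeast-∷ y l (suc i) | atLeast-∷ y l i = +-mono-≤ (bit-anti y i) (atLeast-anti l i)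
  where
  bit-anti : ∀ y i → bit (suc i ≤ᵇ y) ≤ bit (i ≤ᵇ y)
  bit-anti y i with i ≤? y
  ... | yes le rewrite ≤ᵇ-true le = bit≤1 _
  ... | no nle rewrite ≤ᵇ-false (≰⇒> nle) | ≤ᵇ-false (m<n⇒m<1+n (≰⇒> nle)) = z≤n

atLeast-positive : ∀ la i → 1 ≤ i → i ≤ part la 1 → 1 ≤ atLeast la i
atLeast-positive [] i 1≤i le = ⊥-elim (<⇒≱ 1≤i le)
atLeast-positive (x ∷ l) i _ le rewrite atLeast-∷-≤ x l i le = s≤s z≤n

all≤head : ∀ {la} → Decreasing la → All (_≤ part la 1) la
all≤head dec-[] = []
all≤head (dec-one x) = ≤-refl ∷ []
all≤head (dec-∷ x y xs y≤x d) = ≤-refl ∷ All.map (λ le → ≤-trans le y≤x) (all≤head d)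

Σ<-atLeast : ∀ l h → All (_≤ h) l → Σ< h (λ i → atLeast l (suc i)) ≡ size l
Σ<-atLeast [] h _ = Σ<-zero h (λ _ _ → refl)
Σ<-atLeast (y ∷ l) h (y≤h ∷ al) = trans (Σ<-cong h (λ i _ → atLeast-∷ y l (suc i)))
  (trans (Σ<-+ h (λ i → bit (suc i ≤ᵇ y)) (λ i → atLeast l (suc i))) (cong₂ _+_ (count-<ᵇ h y y≤h) (Σ<-atLeast l h al)))

part-map-upFrom : ∀ m (g : ℕ → ℕ) i → suc i ≤ m → part (map g (upFrom 1 m)) (suc i) ≡ g (suc i)
part-map-upFrom (suc m) g zero le = refl
part-map-upFrom (suc m) g (suc i) (s≤s le) =
  trans (cong (λ l → part (map g l) (suc i)) (upFrom-suc 1 m))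
  (trans (cong (λ l → part l (suc i)) (sym (map-∘ {g = g} {f = suc} (upFrom 1 m)))) (part-map-upFrom m (λ x → g (suc x)) i le))

conj≡map-atLeast : ∀ la → conj la ≡ map (atLeast la) (upFrom 1 (part la 1))
conj≡map-atLeast la = cong (map (atLeast la)) (range≡upFrom 1 (suc (part la 1)))

part-conj : ∀ la i → suc i ≤ part la 1 → part (conj la) (suc i) ≡ atLeast la (suc i)
part-conj la i le = trans (cong (λ l → part l (suc i)) (conj≡map-atLeast la)) (part-map-upFrom (part la 1) (atLeast la) i le)

length-conj : ∀ la → length (conj la) ≡ part la 1
length-conj la = trans (cong length (conj≡map-atLeast la)) (trans (length-map (atLeast la) (upFrom 1 (part la 1))) (length-upFrom 1 (part la 1)))

head-conj≤length : ∀ la → part (conj la) 1 ≤ length la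
head-conj≤length la with part la 1 | conj≡map-atLeast la
... | zero | e = subst (λ l → part l 1 ≤ length la) (sym e) z≤n
... | suc h | e = subst (λ l → part l 1 ≤ length la) (sym e) (length-filter (λ x → 1 ≤? x) la)

atLeast-map-upFrom : ∀ (g : ℕ → ℕ) a n j → atLeast (map g (upFrom a n)) j ≡ count n (λ i → j ≤ᵇ g (a + i))
atLeast-map-upFrom g a zero j = refl
atLeast-map-upFrom g a (suc n) j = trans (atLeast-∷ (g a) (map g (upFrom (suc a) n)) j)
  (trans (cong (bit (j ≤ᵇ g a) +_) (atLeast-map-upFrom g (suc a) n j)) (sym (count-suc-upFrom n a (λ k → j ≤ᵇ g k))))

≤ᵇ-atLeast : ∀ {la} → Decreasing la → ∀ i j → 1 ≤ i → 1 ≤ j → (j ≤ᵇ atLeast la i) ≡ (i ≤ᵇ part la j)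
≤ᵇ-atLeast {[]} d i (suc j) 1≤i _ = sym (≤ᵇ-false 1≤i)
≤ᵇ-atLeast {x ∷ l} d i j 1≤i 1≤j with i ≤? x | decreasing-uncons d
... | yes i≤x | dl , hl rewrite atLeast-∷-≤ x l i i≤x = go j 1≤j
  where
  go : ∀ j → 1 ≤ j → (j ≤ᵇ suc (atLeast l i)) ≡ (i ≤ᵇ part (x ∷ l) j)
  go (suc zero) _ = sym (≤ᵇ-true i≤x)
  go (suc (suc j)) _ = ≤ᵇ-atLeast dl i (suc j) 1≤i (s≤s z≤n)
... | no i≰x | dl , hl rewrite atLeast-∷-> x l i (≰⇒> i≰x) | atLeast-beyondHead dl i (≤-<-trans hl (≰⇒> i≰x)) =
  trans (≤ᵇ-false 1≤j) (sym (≤ᵇ-false (≤-<-trans (part≤x j 1≤j) (≰⇒> i≰x))))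
  where
  part≤x : ∀ j → 1 ≤ j → part (x ∷ l) j ≤ x
  part≤x (suc j) _ = part≤head d j

atLeast-conj : ∀ {la} → Decreasing la → ∀ j → 1 ≤ j → atLeast (conj la) j ≡ part la j
atLeast-conj {la} d j 1≤j = trans (cong (λ l → atLeast l j) (conj≡map-atLeast la))
  (trans (atLeast-map-upFrom (atLeast la) 1 (part la 1) j)
  (trans (count-cong (part la 1) (λ i _ → ≤ᵇ-atLeast d (suc i) j (s≤s z≤n) 1≤j))
  (count-<ᵇ (part la 1) (part la j) (part≤λ₁ j 1≤j))))
  where
  part≤λ₁ : ∀ j → 1 ≤ j → part la j ≤ part la 1
  part≤λ₁ (suc j) _ = part≤head d j

head≤head : ∀ {x a y b} → Decreasing b → part b 1 ≤ y → atLeast (x ∷ a) x ≡ atLeast (y ∷ b) x → x ≤ y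
head≤head {x} {a} {y} {b} db hb e with x ≤? y
... | yes le = le
... | no nle with trans (sym (atLeast-∷-≤ x a x ≤-refl)) (trans e (trans (atLeast-∷-> y b x (≰⇒> nle)) (atLeast-beyondHead db x (≤-<-trans hb (≰⇒> nle)))))
... | ()

atLeast-injective : ∀ {a b} → Decreasing a → AllPositive a → Decreasing b → AllPositive b → (∀ j → 1 ≤ j → atLeast a j ≡ atLeast b j) → a ≡ b
atLeast-injective {[]} {[]} _ _ _ _ e = refl
atLeast-injective {[]} {y ∷ b} _ _ _ (pos-∷ 1≤y _) e with trans (e y 1≤y) (atLeast-∷-≤ y b y ≤-refl)
... | ()
atLeast-injective {x ∷ a} {[]} _ (pos-∷ 1≤x _) _ _ e with trans (sym (e x 1≤x)) (atLeast-∷-≤ x a x ≤-refl)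
... | ()
atLeast-injective {x ∷ a} {y ∷ b} da (pos-∷ 1≤x pa) db (pos-∷ 1≤y pb) e with decreasing-uncons da | decreasing-uncons db
... | da′ , ha | db′ , hb = cong₂ _∷_ x≡y (atLeast-injective da′ pa db′ pb sameTails)
  where
  x≡y : x ≡ y
  x≡y = ≤-antisym (head≤head db′ hb (e x 1≤x)) (head≤head da′ ha (sym (e y 1≤y)))
  sameTails : ∀ j → 1 ≤ j → atLeast a j ≡ atLeast b j
  sameTails j 1≤j = +-cancelˡ-≡ (bit (j ≤ᵇ x)) _ _ (trans (sym (atLeast-∷ x a j))
    (trans (e j 1≤j) (trans (atLeast-∷ y b j) (cong (λ k → bit (j ≤ᵇ k) + atLeast b j) (sym x≡y)))))

decreasing-map-upFrom : ∀ (g : ℕ → ℕ) a n → (∀ i → g (suc i) ≤ g i) → Decreasing (map g (upFrom a n))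
decreasing-map-upFrom g a zero _ = dec-[]
decreasing-map-upFrom g a (suc zero) _ = dec-one (g a)
decreasing-map-upFrom g a (suc (suc n)) an = dec-∷ (g a) (g (suc a)) _ (an a) (decreasing-map-upFrom g (suc a) (suc n) an)

allPositive-map-upFrom : ∀ (g : ℕ → ℕ) a n → (∀ i → a ≤ i → i < a + n → 1 ≤ g i) → AllPositive (map g (upFrom a n))
allPositive-map-upFrom g a zero _ = pos-[]
allPositive-map-upFrom g a (suc n) p = pos-∷ (p a ≤-refl (m<m+n a z<s))
  (allPositive-map-upFrom g (suc a) n (λ i a<i i< → p i (<⇒≤ a<i) (subst (i <_) (sym (+-suc a n)) i<)))

conj-isPartition : ∀ {la} → IsPartition la → IsPartition (conj la)
conj-isPartition {la} (d , p) = subst IsPartition (sym (conj≡map-atLeast la))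
  (decreasing-map-upFrom (atLeast la) 1 (part la 1) (atLeast-anti la) , allPositive-map-upFrom (atLeast la) 1 (part la 1) pos)
  where
  pos : ∀ i → 1 ≤ i → i < 1 + part la 1 → 1 ≤ atLeast la i
  pos i 1≤i (s≤s i≤h) = atLeast-positive la i 1≤i i≤h

size-conj : ∀ {la} → Decreasing la → size (conj la) ≡ size la
size-conj {la} d = trans (cong size (conj≡map-atLeast la)) (trans (sum-map-upFrom (atLeast la) 1 (part la 1)) (Σ<-atLeast la (part la 1) (all≤head d)))

firstRowHooks : ℕ → List ℕ → List ℕ
firstRowHooks m la = map (λ j → (m ∸ j) + atLeast la j + 1) (upFrom 1 m)

hookRow : List ℕ → ℕ → List ℕ
hookRow la i = map (λ j → (part la i ∸ j) + (part (conj la) j ∸ i) + 1) (range 1 (suc (part la i)))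

hooks≡concatMap-hookRow : ∀ la → hooks la ≡ concatMap (hookRow la) (upFrom 1 (length la))
hooks≡concatMap-hookRow la = cong (concatMap (hookRow la)) (range≡upFrom 1 (suc (length la)))

hooks-∷ : ∀ m la → Decreasing la → part la 1 ≤ m → hooks (m ∷ la) ≡ firstRowHooks m la ++ hooks la
hooks-∷ m la d λ₁≤m = trans (hooks≡concatMap-hookRow (m ∷ la)) (cong₂ _++_ firstRow lowerRows)
  where
  conj-∷ : ∀ j → suc j ≤ m → part (conj (m ∷ la)) (suc j) ≡ suc (atLeast la (suc j))
  conj-∷ j j<m = trans (part-conj (m ∷ la) j j<m) (atLeast-∷-≤ m la (suc j) j<m)
  firstRow : hookRow (m ∷ la) 1 ≡ firstRowHooks m la
  firstRow = trans (cong (map _) (range≡upFrom 1 (suc m))) (map-cong-upFrom 1 m leg)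
    where
    leg : ∀ j → 1 ≤ j → j < 1 + m → (m ∸ j) + (part (conj (m ∷ la)) j ∸ 1) + 1 ≡ (m ∸ j) + atLeast la j + 1
    leg (suc j) _ (s≤s j<m) = cong (λ k → (m ∸ suc j) + (k ∸ 1) + 1) (conj-∷ j j<m)
  lowerRow : ∀ i → 1 ≤ i → i < 1 + length la → hookRow (m ∷ la) (suc i) ≡ hookRow la i
  lowerRow (suc i) _ _ = trans (cong (map _) (range≡upFrom 1 (suc (part la (suc i)))))
    (trans (map-cong-upFrom 1 (part la (suc i)) leg) (sym (cong (map _) (range≡upFrom 1 (suc (part la (suc i)))))))
    where
    leg : ∀ j → 1 ≤ j → j < 1 + part la (suc i) →
      (part la (suc i) ∸ j) + (part (conj (m ∷ la)) j ∸ suc (suc i)) + 1 ≡ (part la (suc i) ∸ j) + (part (conj la) j ∸ suc i) + 1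
    leg (suc j) _ (s≤s j<λᵢ) = cong (λ k → (part la (suc i) ∸ suc j) + k + 1)
      (trans (cong (_∸ suc (suc i)) (conj-∷ j (≤-trans j<λ₁ λ₁≤m))) (sym (cong (_∸ suc i) (part-conj la j j<λ₁))))
      where
      j<λ₁ : suc j ≤ part la 1
      j<λ₁ = ≤-trans j<λᵢ (part≤head d i)
  lowerRows : concatMap (hookRow (m ∷ la)) (upFrom 2 (length la)) ≡ hooks la
  lowerRows = trans (cong (concatMap (hookRow (m ∷ la))) (upFrom-suc 1 (length la)))
    (trans (concatMap-map (hookRow (m ∷ la)) suc (upFrom 1 (length la)))
    (trans (concatMap-cong-upFrom 1 (length la) lowerRow) (sym (hooks≡concatMap-hookRow la))))

-- Partitions encoded by 0/1-words

ones zeros : (ℕ → Bool) → ℕ → ℕ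
ones f L = count L f
zeros f L = count L (λ x → not (f x))

ones+zeros : ∀ f L → ones f L + zeros f L ≡ L
ones+zeros f L = trans (sym (Σ<-+ L (λ x → bit (f x)) (λ x → bit (not (f x)))))
  (trans (Σ<-cong L (λ x _ → bit-not (f x))) (trans (Σ<-const L 1) (*-identityʳ L)))

consPart : ℕ → List ℕ → List ℕ
consPart zero l = l
consPart (suc m) l = suc m ∷ l

shapeStep : Bool → ℕ → List ℕ → List ℕ
shapeStep true m l = l
shapeStep false m l = consPart m l

shape : (ℕ → Bool) → ℕ → List ℕ
shape f zero = []
shape f (suc L) = shapeStep (f L) (ones f L) (shape f L)

shape-cong : ∀ L {f g : ℕ → Bool} → (∀ x → x < L → f x ≡ g x) → shape f L ≡ shape g L
shape-cong zero e = refl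
shape-cong (suc L) {f} {g} e with f L | g L | e L ≤-refl
... | b | .b | refl = cong₂ (shapeStep b) (count-cong L e<) (shape-cong L e<)
  where
  e< : ∀ x → x < L → f x ≡ g x
  e< x x<L = e x (m<n⇒m<1+n x<L)

shape-invariant : ∀ f L → IsPartition (shape f L) × part (shape f L) 1 ≤ ones f L
shape-invariant f zero = (dec-[] , pos-[]) , z≤n
shape-invariant f (suc L) with f L | shape-invariant f L
... | true | ip , le = ip , ≤-trans le (m≤m+n (ones f L) 1)
... | false | ip , le = consPart-isPartition (ones f L) ip le , subst (part (consPart (ones f L) (shape f L)) 1 ≤_) (sym (+-identityʳ (ones f L))) (head-consPart (ones f L) le)
  where
  consPart-isPartition : ∀ m {l} → IsPartition l → part l 1 ≤ m → IsPartition (consPart m l)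
  consPart-isPartition zero ip le = ip
  consPart-isPartition (suc m) {l} (d , p) le = decreasing-∷ (suc m) l d le , pos-∷ (s≤s z≤n) p
  head-consPart : ∀ m {l} → part l 1 ≤ m → part (consPart m l) 1 ≤ m
  head-consPart zero le = le
  head-consPart (suc m) le = ≤-refl

shape-isPartition : ∀ f L → IsPartition (shape f L)
shape-isPartition f L = proj₁ (shape-invariant f L)

head-shape≤ones : ∀ f L → part (shape f L) 1 ≤ ones f L
head-shape≤ones f L = proj₂ (shape-invariant f L)

shape-noOnes : ∀ f L → ones f L ≡ 0 → shape f L ≡ []
shape-noOnes f L e = allPositive-head≡0 (proj₂ (shape-isPartition f L)) (n≤0⇒n≡0 (subst (part (shape f L) 1 ≤_) e (head-shape≤ones f L)))

countTrue : List Bool → ℕ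
countTrue [] = 0
countTrue (true ∷ w) = suc (countTrue w)
countTrue (false ∷ w) = countTrue w

countTrue-∷ʳ : ∀ w b → countTrue (w ++ [ b ]) ≡ countTrue w + bit b
countTrue-∷ʳ [] true = refl
countTrue-∷ʳ [] false = refl
countTrue-∷ʳ (true ∷ w) b = cong suc (countTrue-∷ʳ w b)
countTrue-∷ʳ (false ∷ w) b = countTrue-∷ʳ w b

countTrue-map-upTo : ∀ f L → countTrue (map f (upTo L)) ≡ ones f L
countTrue-map-upTo f zero = refl
countTrue-map-upTo f (suc L) = trans (cong countTrue (map-upTo-suc f L))
  (trans (countTrue-∷ʳ (map f (upTo L)) (f L)) (cong (_+ bit (f L)) (countTrue-map-upTo f L)))

decodeAux-∷ʳ : ∀ c w b → decodeAux c (w ++ [ b ]) ≡ decodeAux c w ++ (if b then [] else [ c + countTrue w ])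
decodeAux-∷ʳ c [] true = refl
decodeAux-∷ʳ c [] false = cong [_] (sym (+-identityʳ c))
decodeAux-∷ʳ c (true ∷ w) b = trans (decodeAux-∷ʳ (suc c) w b)
  (cong (λ x → decodeAux (suc c) w ++ (if b then [] else [ x ])) (sym (+-suc c (countTrue w))))
decodeAux-∷ʳ c (false ∷ w) b = cong (c ∷_) (decodeAux-∷ʳ c w b)

decode-∷ʳ : ∀ w b → decode (w ++ [ b ]) ≡ shapeStep b (countTrue w) (decode w)
decode-∷ʳ w true = cong (λ l → reverse (filter (1 ≤?_) l)) (trans (decodeAux-∷ʳ 0 w true) (++-identityʳ _))
decode-∷ʳ w false = begin
  reverse (filter (1 ≤?_) (decodeAux 0 (w ++ [ false ])))                 ≡⟨ cong (λ l → reverse (filter (1 ≤?_) l)) (decodeAux-∷ʳ 0 w false) ⟩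
  reverse (filter (1 ≤?_) (decodeAux 0 w ++ [ countTrue w ]))            ≡⟨ cong reverse (filter-++ (1 ≤?_) (decodeAux 0 w) [ countTrue w ]) ⟩
  reverse (filter (1 ≤?_) (decodeAux 0 w) ++ filter (1 ≤?_) [ countTrue w ]) ≡⟨ reverse-++ (filter (1 ≤?_) (decodeAux 0 w)) _ ⟩
  reverse (filter (1 ≤?_) [ countTrue w ]) ++ decode w                    ≡⟨ consPositive (countTrue w) ⟩
  consPart (countTrue w) (decode w)                                      ∎
  where
  open ≡-Reasoning
  consPositive : ∀ k → reverse (filter (1 ≤?_) [ k ]) ++ decode w ≡ consPart k (decode w)
  consPositive zero = refl
  consPositive (suc k) = refl

decode≡shape : ∀ f L → decode (map f (upTo L)) ≡ shape f L
decode≡shape f zero = refl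
decode≡shape f (suc L) = trans (cong decode (map-upTo-suc f L)) (trans (decode-∷ʳ (map f (upTo L)) (f L))
  (cong₂ (shapeStep (f L)) (countTrue-map-upTo f L) (decode≡shape f L)))

onesFollowedByZeros : (ℕ → Bool) → ℕ → ℕ → ℕ
onesFollowedByZeros f L j = count L (λ y → f y ∧ (j ≤ᵇ zeros f L ∸ zeros f (suc y)))

zeros-mono : ∀ f {y L} → y < L → zeros f (suc y) ≤ zeros f L
zeros-mono f y<L = count-mono (λ x → not (f x)) y<L

onesFollowedByZeros-one : ∀ f L j → f L ≡ true → onesFollowedByZeros f (suc L) (suc j) ≡ onesFollowedByZeros f L (suc j)
onesFollowedByZeros-one f L j fL = trans (cong₂ _+_ (count-cong L (λ y _ → cong (λ z → f y ∧ (suc j ≤ᵇ z ∸ zeros f (suc y))) zeros≡)) lastIgnored)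
  (+-identityʳ _)
  where
  zeros≡ : zeros f (suc L) ≡ zeros f L
  zeros≡ = trans (cong (λ b → zeros f L + bit (not b)) fL) (+-identityʳ _)
  lastIgnored : bit (f L ∧ (suc j ≤ᵇ zeros f (suc L) ∸ zeros f (suc L))) ≡ 0
  lastIgnored = trans (cong (λ n → bit (f L ∧ (suc j ≤ᵇ n))) (n∸n≡0 (zeros f (suc L)))) (cong bit (∧-zeroʳ (f L)))

module _ (f : ℕ → Bool) (L : ℕ) (fL : f L ≡ false) where

  private
    zerosAfter-suc : ∀ y → y < L → zeros f (suc L) ∸ zeros f (suc y) ≡ suc (zeros f L ∸ zeros f (suc y))
    zerosAfter-suc y y<L = trans (cong (λ b → zeros f L + bit (not b) ∸ zeros f (suc y)) fL)
      (trans (cong (_∸ zeros f (suc y)) (+-comm (zeros f L) 1)) (+-∸-assoc 1 (zeros-mono f y<L)))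

    step : ∀ j → onesFollowedByZeros f (suc L) j ≡ count L (λ y → f y ∧ (j ≤ᵇ suc (zeros f L ∸ zeros f (suc y))))
    step j = trans (cong₂ _+_ (count-cong L (λ y y<L → cong (λ n → f y ∧ (j ≤ᵇ n)) (zerosAfter-suc y y<L))) (cong (λ b → bit (b ∧ (j ≤ᵇ zeros f (suc L) ∸ zeros f (suc L)))) fL))
      (+-identityʳ _)

  onesFollowedByZeros-zero-head : onesFollowedByZeros f (suc L) 1 ≡ ones f L
  onesFollowedByZeros-zero-head = trans (step 1) (count-cong L (λ y _ → ∧-identityʳ (f y)))

  onesFollowedByZeros-zero-tail : ∀ j → onesFollowedByZeros f (suc L) (suc (suc j)) ≡ onesFollowedByZeros f L (suc j)
  onesFollowedByZeros-zero-tail j = step (suc (suc j))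

part-consPart-head : ∀ m {l} → part l 1 ≤ m → part (consPart m l) 1 ≡ m
part-consPart-head zero le = n≤0⇒n≡0 le
part-consPart-head (suc m) le = refl

part-consPart-tail : ∀ m {l} → Decreasing l → part l 1 ≤ m → ∀ j → part (consPart m l) (suc (suc j)) ≡ part l (suc j)
part-consPart-tail zero d le j = trans (n≤0⇒n≡0 (≤-trans (part≤head d (suc j)) le)) (sym (n≤0⇒n≡0 (≤-trans (part≤head d j) le)))
part-consPart-tail (suc m) d le j = refl

part-shape : ∀ f L j → part (shape f L) (suc j) ≡ onesFollowedByZeros f L (suc j)
part-shape f zero j = refl
part-shape f (suc L) = byLastLetter (f L) refl
  where
  byLastLetter : ∀ b → f L ≡ b → ∀ j → part (shapeStep b (ones f L) (shape f L)) (suc j) ≡ onesFollowedByZeros f (suc L) (suc j)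
  byLastLetter true fL j = trans (part-shape f L j) (sym (onesFollowedByZeros-one f L j fL))
  byLastLetter false fL zero = trans (part-consPart-head (ones f L) (head-shape≤ones f L)) (sym (onesFollowedByZeros-zero-head f L fL))
  byLastLetter false fL (suc j) = trans (part-consPart-tail (ones f L) (proj₁ (shape-isPartition f L)) (head-shape≤ones f L) j)
    (trans (part-shape f L j) (sym (onesFollowedByZeros-zero-tail f L fL j)))

atLeast-consPart : ∀ m l j → atLeast (consPart m l) (suc j) ≡ bit (suc j ≤ᵇ m) + atLeast l (suc j)
atLeast-consPart zero l j = refl
atLeast-consPart (suc m) l j = atLeast-∷ (suc m) l (suc j)

atLeast-shape : ∀ f L j → atLeast (shape f L) (suc j) ≡ count L (λ x → not (f x) ∧ (suc j ≤ᵇ ones f x))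
atLeast-shape f zero j = refl
atLeast-shape f (suc L) j with f L
... | true = trans (atLeast-shape f L j) (sym (+-identityʳ _))
... | false = trans (atLeast-consPart (ones f L) (shape f L) j)
  (trans (+-comm _ (atLeast (shape f L) (suc j))) (cong (_+ bit (suc j ≤ᵇ ones f L)) (atLeast-shape f L j)))

reflect : (ℕ → Bool) → ℕ → ℕ → Bool
reflect f L x = not (f (L ∸ suc x))

∸≡suc∸suc : ∀ {L x} → x < L → L ∸ x ≡ suc (L ∸ suc x)
∸≡suc∸suc {suc L} {zero} _ = refl
∸≡suc∸suc {suc L} {suc x} (s≤s x<L) = ∸≡suc∸suc x<L

ones-reflect : ∀ f L x → x ≤ L → ones (reflect f L) x + zeros f (L ∸ x) ≡ zeros f L
ones-reflect f L zero _ = refl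
ones-reflect f L (suc x) x<L = begin
  ones (reflect f L) x + bit (not (f (L ∸ suc x))) + zeros f (L ∸ suc x) ≡⟨ +-assoc (ones (reflect f L) x) _ _ ⟩
  ones (reflect f L) x + (bit (not (f (L ∸ suc x))) + zeros f (L ∸ suc x)) ≡⟨ cong (ones (reflect f L) x +_) (+-comm _ (zeros f (L ∸ suc x))) ⟩
  ones (reflect f L) x + zeros f (suc (L ∸ suc x))                         ≡⟨ cong (λ k → ones (reflect f L) x + zeros f k) (∸≡suc∸suc x<L) ⟨
  ones (reflect f L) x + zeros f (L ∸ x)                                   ≡⟨ ones-reflect f L x (<⇒≤ x<L) ⟩
  zeros f L                                                                ∎
  where open ≡-Reasoning

zeros-reflect : ∀ f L → zeros (reflect f L) L ≡ ones f L
zeros-reflect f L = trans (count-cong L (λ x _ → not-involutive (f (L ∸ suc x)))) (Σ<-rev L (λ y → bit (f y)))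

atLeast-shape-reflect : ∀ f L j → atLeast (shape (reflect f L) L) (suc j) ≡ part (shape f L) (suc j)
atLeast-shape-reflect f L j = begin
  atLeast (shape (reflect f L) L) (suc j)                   ≡⟨ atLeast-shape (reflect f L) L j ⟩
  count L (λ x → not (reflect f L x) ∧ (suc j ≤ᵇ ones (reflect f L) x)) ≡⟨ count-cong L mirror ⟩
  count L (λ x → h (L ∸ suc x))                             ≡⟨ Σ<-rev L (λ y → bit (h y)) ⟩
  onesFollowedByZeros f L (suc j)                           ≡⟨ part-shape f L j ⟨
  part (shape f L) (suc j)                                  ∎
  where
  open ≡-Reasoning
  h : ℕ → Bool
  h y = f y ∧ (suc j ≤ᵇ zeros f L ∸ zeros f (suc y))
  onesBefore≡zerosAfter : ∀ x → x < L → ones (reflect f L) x ≡ zeros f L ∸ zeros f (suc (L ∸ suc x))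
  onesBefore≡zerosAfter x x<L = trans (sym (m+n∸n≡m (ones (reflect f L) x) (zeros f (L ∸ x))))
    (cong₂ _∸_ (ones-reflect f L x (<⇒≤ x<L)) (cong (zeros f) (∸≡suc∸suc x<L)))
  mirror : ∀ x → x < L → (not (reflect f L x) ∧ (suc j ≤ᵇ ones (reflect f L) x)) ≡ h (L ∸ suc x)
  mirror x x<L = cong₂ _∧_ (not-involutive (f (L ∸ suc x))) (cong (suc j ≤ᵇ_) (onesBefore≡zerosAfter x x<L))

shape-reflect : ∀ f L → shape (reflect f L) L ≡ conj (shape f L)
shape-reflect f L = atLeast-injective (proj₁ (shape-isPartition (reflect f L) L)) (proj₂ (shape-isPartition (reflect f L) L))
  (proj₁ conj-shape) (proj₂ conj-shape) sameCounts
  where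
  conj-shape : IsPartition (conj (shape f L))
  conj-shape = conj-isPartition (shape-isPartition f L)
  sameCounts : ∀ j → 1 ≤ j → atLeast (shape (reflect f L) L) j ≡ atLeast (conj (shape f L)) j
  sameCounts (suc j) _ = trans (atLeast-shape-reflect f L j) (sym (atLeast-conj (proj₁ (shape-isPartition f L)) (suc j) (s≤s z≤n)))

onesDistances : (ℕ → Bool) → ℕ → List ℕ
onesDistances f zero = []
onesDistances f (suc L) = map suc (onesDistances f L) ++ (if f L then [ 1 ] else [])

hooksEndingAt : (ℕ → Bool) → ℕ → List ℕ
hooksEndingAt f L = if f L then [] else onesDistances f L

wordHooks : (ℕ → Bool) → ℕ → List ℕ
wordHooks f zero = []
wordHooks f (suc L) = hooksEndingAt f L ++ wordHooks f L

firstRowHooks-suc : ∀ m la → atLeast la (suc m) ≡ 0 → firstRowHooks (suc m) la ≡ map suc (firstRowHooks m la) ++ [ 1 ]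
firstRowHooks-suc m la noneLonger = trans (cong (map _) (upFrom-∷ʳ 1 m)) (trans (map-++ _ (upFrom 1 m) [ suc m ])
  (cong₂ _++_ (trans (map-cong-upFrom 1 m shift) (map-∘ (upFrom 1 m))) (cong [_] lastBox)))
  where
  shift : ∀ j → 1 ≤ j → j < 1 + m → (suc m ∸ j) + atLeast la j + 1 ≡ suc ((m ∸ j) + atLeast la j + 1)
  shift j _ (s≤s j≤m) = cong (λ k → k + atLeast la j + 1) (+-∸-assoc 1 j≤m)
  lastBox : (suc m ∸ suc m) + atLeast la (suc m) + 1 ≡ 1
  lastBox = cong₂ (λ a b → a + b + 1) (n∸n≡0 m) noneLonger

firstRowHooks-consPart : ∀ m la → firstRowHooks m (consPart m la) ≡ map suc (firstRowHooks m la)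
firstRowHooks-consPart zero la = refl
firstRowHooks-consPart (suc m) la = trans (map-cong-upFrom 1 (suc m) oneMore) (map-∘ (upFrom 1 (suc m)))
  where
  oneMore : ∀ j → 1 ≤ j → j < 1 + suc m → (suc m ∸ j) + atLeast (suc m ∷ la) j + 1 ≡ suc ((suc m ∸ j) + atLeast la j + 1)
  oneMore j _ (s≤s j≤m) = trans (cong (λ k → (suc m ∸ j) + k + 1) (atLeast-∷-≤ (suc m) la j j≤m)) (cong (_+ 1) (+-suc (suc m ∸ j) (atLeast la j)))

firstRowHooks-shape : ∀ f L → firstRowHooks (ones f L) (shape f L) ≡ onesDistances f L
firstRowHooks-shape f zero = refl
firstRowHooks-shape f (suc L) = byLastLetter (f L)
  where
  byLastLetter : ∀ b → firstRowHooks (ones f L + bit b) (shapeStep b (ones f L) (shape f L)) ≡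
                       map suc (onesDistances f L) ++ (if b then [ 1 ] else [])
  byLastLetter true = begin
    firstRowHooks (ones f L + 1) (shape f L)             ≡⟨ cong (λ k → firstRowHooks k (shape f L)) (+-comm (ones f L) 1) ⟩
    firstRowHooks (suc (ones f L)) (shape f L)           ≡⟨ firstRowHooks-suc (ones f L) (shape f L) noneLonger ⟩
    map suc (firstRowHooks (ones f L) (shape f L)) ++ [ 1 ] ≡⟨ cong (λ l → map suc l ++ [ 1 ]) (firstRowHooks-shape f L) ⟩
    map suc (onesDistances f L) ++ [ 1 ]                 ∎
    where
    open ≡-Reasoning
    noneLonger : atLeast (shape f L) (suc (ones f L)) ≡ 0
    noneLonger = atLeast-beyondHead (proj₁ (shape-isPartition f L)) (suc (ones f L)) (s≤s (head-shape≤ones f L))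
  byLastLetter false = begin
    firstRowHooks (ones f L + 0) (consPart (ones f L) (shape f L)) ≡⟨ cong (λ k → firstRowHooks k (consPart (ones f L) (shape f L))) (+-identityʳ (ones f L)) ⟩
    firstRowHooks (ones f L) (consPart (ones f L) (shape f L))     ≡⟨ firstRowHooks-consPart (ones f L) (shape f L) ⟩
    map suc (firstRowHooks (ones f L) (shape f L))                 ≡⟨ cong (map suc) (firstRowHooks-shape f L) ⟩
    map suc (onesDistances f L)                                    ≡⟨ ++-identityʳ _ ⟨
    map suc (onesDistances f L) ++ []                              ∎
    where open ≡-Reasoning

hooks-consPart : ∀ m l → Decreasing l → part l 1 ≤ m → hooks (consPart m l) ≡ firstRowHooks m l ++ hooks l
hooks-consPart zero l d le = refl
hooks-consPart (suc m) l d le = hooks-∷ (suc m) l d le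

hooks-shape : ∀ f L → hooks (shape f L) ≡ wordHooks f L
hooks-shape f zero = refl
hooks-shape f (suc L) = byLastLetter (f L)
  where
  byLastLetter : ∀ b → hooks (shapeStep b (ones f L) (shape f L)) ≡ (if b then [] else onesDistances f L) ++ wordHooks f L
  byLastLetter true = hooks-shape f L
  byLastLetter false = trans (hooks-consPart (ones f L) (shape f L) (proj₁ (shape-isPartition f L)) (head-shape≤ones f L))
    (cong₂ _++_ (firstRowHooks-shape f L) (hooks-shape f L))

triangle : ℕ → ℕ
triangle n = Σ< n (λ x → x)

zeroPositionSum : (ℕ → Bool) → ℕ → ℕ
zeroPositionSum f L = Σ< L (λ x → bit (not (f x)) * x)

size-consPart : ∀ m l → size (consPart m l) ≡ m + size l
size-consPart zero l = refl
size-consPart (suc m) l = refl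

-- The k-th letter 0 (counting from k = 0), at position p, contributes the part p ∸ k.
size-shape : ∀ f L → size (shape f L) + triangle (zeros f L) ≡ zeroPositionSum f L
size-shape f zero = refl
size-shape f (suc L) = byLastLetter (f L)
  where
  open ≡-Reasoning
  byLastLetter : ∀ b → size (shapeStep b (ones f L) (shape f L)) + triangle (zeros f L + bit (not b)) ≡
                       zeroPositionSum f L + bit (not b) * L
  byLastLetter true = begin
    size (shape f L) + triangle (zeros f L + 0) ≡⟨ cong (λ n → size (shape f L) + triangle n) (+-identityʳ (zeros f L)) ⟩
    size (shape f L) + triangle (zeros f L)     ≡⟨ size-shape f L ⟩
    zeroPositionSum f L                         ≡⟨ +-identityʳ _ ⟨
    zeroPositionSum f L + 0                     ∎
  byLastLetter false = begin
    size (consPart (ones f L) (shape f L)) + triangle (zeros f L + 1)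
      ≡⟨ cong₂ _+_ (size-consPart (ones f L) (shape f L)) (cong triangle (+-comm (zeros f L) 1)) ⟩
    ones f L + size (shape f L) + (triangle (zeros f L) + zeros f L)
      ≡⟨ regroup (ones f L) (size (shape f L)) (triangle (zeros f L)) (zeros f L) ⟩
    (size (shape f L) + triangle (zeros f L)) + (ones f L + zeros f L)
      ≡⟨ cong₂ _+_ (size-shape f L) (ones+zeros f L) ⟩
    zeroPositionSum f L + L
      ≡⟨ cong (zeroPositionSum f L +_) (+-identityʳ L) ⟨
    zeroPositionSum f L + (L + 0)                 ∎
    where
    regroup : ∀ a b c d → a + b + (c + d) ≡ (b + c) + (a + d)
    regroup = solve-∀

ones≡0⇒false : ∀ f L → ones f L ≡ 0 → ∀ p → p < L → f p ≡ false
ones≡0⇒false f (suc L) none p p<1+L with f L in fL | m≤n⇒m<n∨m≡n (≤-pred p<1+L)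
... | true | _ = ⊥-elim (1+n≢0 (trans (+-comm 1 (ones f L)) none))
... | false | inj₁ p<L = ones≡0⇒false f L (trans (sym (+-identityʳ _)) none) p p<L
... | false | inj₂ refl = fL

shape-trailingOnes : ∀ f {a} L → a ≤ L → (∀ i → a ≤ i → i < L → f i ≡ true) → shape f L ≡ shape f a × zeros f L ≡ zeros f a
shape-trailingOnes f zero z≤n _ = refl , refl
shape-trailingOnes f {a} (suc L) a≤1+L allOnes with m≤n⇒m<n∨m≡n a≤1+L
... | inj₂ refl = refl , refl
... | inj₁ a<1+L = trans shape-last (proj₁ ih) , trans zeros-last (proj₂ ih)
  where
  ih : shape f L ≡ shape f a × zeros f L ≡ zeros f a
  ih = shape-trailingOnes f L (≤-pred a<1+L) (λ i a≤i i<L → allOnes i a≤i (m<n⇒m<1+n i<L))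
  fL : f L ≡ true
  fL = allOnes L (≤-pred a<1+L) ≤-refl
  shape-last : shape f (suc L) ≡ shape f L
  shape-last = cong (λ b → shapeStep b (ones f L) (shape f L)) fL
  zeros-last : zeros f (suc L) ≡ zeros f L
  zeros-last = trans (cong (λ b → zeros f L + bit (not b)) fL) (+-identityʳ _)

sortedWord : ℕ → ℕ → Bool
sortedWord c p = not (p <ᵇ c)

Sorted : ℕ → (ℕ → Bool) → ℕ → Set
Sorted c f L = ∀ p → p < L → f p ≡ sortedWord c p

shape-sorted : ∀ c f L → Sorted c f L → shape f L ≡ []
shape-sorted c f L sorted = trans (shape-cong L sorted) (shape-sortedWord L)
  where
  shape-sortedWord : ∀ L → shape (sortedWord c) L ≡ []
  shape-sortedWord zero = refl
  shape-sortedWord (suc L) with L <? c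
  ... | yes L<c = trans (cong₂ (λ b m → shapeStep b m (shape (sortedWord c) L)) (cong not (<ᵇ-true L<c)) noOnes) (shape-sortedWord L)
    where
    noOnes : ones (sortedWord c) L ≡ 0
    noOnes = Σ<-zero L (λ p p<L → cong (λ b → bit (not b)) (<ᵇ-true (<-trans p<L L<c)))
  ... | no L≮c = trans (cong (λ b → shapeStep b (ones (sortedWord c) L) (shape (sortedWord c) L)) (cong not (<ᵇ-false (≮⇒≥ L≮c))))
    (shape-sortedWord L)

wordHooks-sorted : ∀ c f L → Sorted c f L → wordHooks f L ≡ []
wordHooks-sorted c f L sorted = trans (sym (hooks-shape f L)) (cong hooks (shape-sorted c f L sorted))

zeros-sorted : ∀ c f L → c ≤ L → Sorted c f L → zeros f L ≡ c
zeros-sorted c f L c≤L sorted =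
  trans (count-cong L (λ p p<L → trans (cong not (sorted p p<L)) (not-involutive (p <ᵇ c)))) (count-<ᵇ L c c≤L)

length-shape : ∀ f L → length (shape f L) ≤ zeros f L
length-shape f zero = z≤n
length-shape f (suc L) = byLastLetter (f L)
  where
  byLastLetter : ∀ b → length (shapeStep b (ones f L) (shape f L)) ≤ zeros f L + bit (not b)
  byLastLetter true = ≤-trans (length-shape f L) (m≤m+n _ 0)
  byLastLetter false with ones f L
  ... | zero = ≤-trans (length-shape f L) (m≤m+n _ 1)
  ... | suc m = subst (suc (length (shape f L)) ≤_) (+-comm 1 (zeros f L)) (s≤s (length-shape f L))

-- The boundary word of a partition

-- Defs.letter with the origin moved to c: the letters 0 sit at the positions c ∸ j + part la j for j ≥ 1
-- (for j > length la these are all positions below c ∸ length la).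
boundary : List ℕ → ℕ → ℕ → Bool
boundary [] c p = not (p <ᵇ c)
boundary (x ∷ la) c p = boundary la (c ∸ 1) p ∧ not (p ≡ᵇ (x + c ∸ 1))

boundary-∷ : ∀ x la c p → boundary (x ∷ la) (suc c) p ≡ boundary la c p ∧ not (p ≡ᵇ (x + c))
boundary-∷ x la c p = cong (λ k → boundary la c p ∧ not (p ≡ᵇ k)) (cong (_∸ 1) (+-suc x c))

boundary-top : ∀ {la} → IsPartition la → ∀ c p → c + part la 1 ≤ p → boundary la c p ≡ true
boundary-top {[]} _ c p c≤p = cong not (<ᵇ-false (subst (_≤ p) (+-identityʳ c) c≤p))
boundary-top {x ∷ la} (d , pos-∷ 1≤x pl) c p c+x≤p with decreasing-uncons d
... | dl , hl = trans (cong (λ b → boundary la (c ∸ 1) p ∧ not b) (≡ᵇ-false p≢)) (trans (∧-identityʳ _)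
  (boundary-top (dl , pl) (c ∸ 1) p (≤-trans (+-mono-≤ (m∸n≤m c 1) hl) c+x≤p)))
  where
  x+c∸1<p : x + c ∸ 1 < p
  x+c∸1<p with x + c | ≤-trans 1≤x (m≤m+n x c) | subst (_≤ p) (+-comm c x) c+x≤p
  ... | suc n | _ | n<p = n<p
  p≢ : p ≢ x + c ∸ 1
  p≢ eq = <⇒≢ x+c∸1<p (sym eq)

consPart-positive : ∀ {x l} → 1 ≤ x → consPart x l ≡ x ∷ l
consPart-positive {suc x} _ = refl

shape-boundary : ∀ la → IsPartition la → ∀ c → length la ≤ c → ∀ L → c + part la 1 ≤ L →
  shape (boundary la c) L ≡ la × zeros (boundary la c) L ≡ c
shape-boundary [] _ c _ L c≤L = shape-sorted c (boundary [] c) L (λ _ _ → refl) , zeros-sorted c (boundary [] c) L (subst (_≤ L) (+-identityʳ c) c≤L) (λ _ _ → refl)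
shape-boundary (x ∷ la) ip@(d , pos-∷ 1≤x pl) (suc c) (s≤s ℓ≤c) L le with decreasing-uncons d
... | dl , hl = trans (proj₁ afterQ) shapeQ+1 , trans (proj₂ afterQ) zerosQ+1
  where
  g g' : ℕ → Bool
  g = boundary (x ∷ la) (suc c)
  g' = boundary la c
  q = x + c
  q≡ : suc c + x ≡ suc q
  q≡ = trans (+-comm (suc c) x) (+-suc x c)
  gq : g q ≡ false
  gq = trans (boundary-∷ x la c q) (trans (cong (λ b → g' q ∧ not b) (≡ᵇ-true {q} refl)) (∧-zeroʳ _))
  below : ∀ p → p < q → g p ≡ g' p
  below p p<q = trans (boundary-∷ x la c p) (trans (cong (λ b → g' p ∧ not b) (≡ᵇ-false (<⇒≢ p<q))) (∧-identityʳ _))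
  ih : shape g' q ≡ la × zeros g' q ≡ c
  ih = shape-boundary la (dl , pl) c ℓ≤c q (subst (_≤ q) (+-comm (part la 1) c) (+-monoˡ-≤ c hl))
  zerosQ : zeros g q ≡ c
  zerosQ = trans (count-cong q (λ p p<q → cong not (below p p<q))) (proj₂ ih)
  onesQ : ones g q ≡ x
  onesQ = +-cancelʳ-≡ c _ _ (trans (cong (ones g q +_) (sym zerosQ)) (ones+zeros g q))
  afterQ : shape g L ≡ shape g (suc q) × zeros g L ≡ zeros g (suc q)
  afterQ = shape-trailingOnes g L (subst (_≤ L) q≡ le) (λ i q<i _ → boundary-top ip (suc c) i (subst (_≤ i) (sym q≡) q<i))
  shapeQ+1 : shape g (suc q) ≡ x ∷ la
  shapeQ+1 = trans (cong (λ b → shapeStep b (ones g q) (shape g q)) gq)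
    (trans (cong₂ consPart onesQ (trans (shape-cong q below) (proj₁ ih))) (consPart-positive 1≤x))
  zerosQ+1 : zeros g (suc q) ≡ suc c
  zerosQ+1 = trans (cong (λ b → zeros g q + bit (not b)) gq) (trans (cong (_+ 1) zerosQ) (+-comm c 1))

shape-fits : ∀ f L → zeros f L + part (shape f L) 1 ≤ L
shape-fits f L = ≤-trans (+-monoʳ-≤ (zeros f L) (head-shape≤ones f L)) (≤-reflexive (trans (+-comm (zeros f L) (ones f L)) (ones+zeros f L)))

boundary-shape : ∀ f L p → p < L → boundary (shape f L) (zeros f L) p ≡ f p
boundary-shape f (suc L) p p<1+L with f L in fL | m≤n⇒m<n∨m≡n (≤-pred p<1+L)
... | true | inj₁ p<L = trans (cong (λ c → boundary (shape f L) c p) (+-identityʳ (zeros f L))) (boundary-shape f L p p<L)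
... | true | inj₂ refl = trans (cong (λ c → boundary (shape f L) c p) (+-identityʳ (zeros f L)))
  (trans (boundary-top (shape-isPartition f L) (zeros f L) p (shape-fits f L)) (sym fL))
... | false | p≤L = trans (cong (λ c → boundary (consPart (ones f L) (shape f L)) c p) (+-comm (zeros f L) 1)) (newPart (ones f L) refl)
  where
  fp : ones f L ≡ 0 → f p ≡ false
  fp none = [ ones≡0⇒false f L none p , (λ p≡L → trans (cong f p≡L) fL) ]′ p≤L
  newPart : ∀ m → ones f L ≡ m → boundary (consPart m (shape f L)) (suc (zeros f L)) p ≡ f p
  newPart zero none = trans (cong (λ l → boundary l (suc (zeros f L)) p) (shape-noOnes f L none))
    (trans (cong not (<ᵇ-true (s≤s (≤-trans (≤-pred p<1+L) (≤-reflexive zerosAll))))) (sym (fp none)))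
    where
    zerosAll : L ≡ zeros f L
    zerosAll = trans (sym (ones+zeros f L)) (cong (_+ zeros f L) none)
  newPart (suc m) e = trans (boundary-∷ (suc m) (shape f L) (zeros f L) p) (atNewZero p≤L)
    where
    m+z≡L : suc m + zeros f L ≡ L
    m+z≡L = trans (cong (_+ zeros f L) (sym e)) (ones+zeros f L)
    atNewZero : p < L ⊎ p ≡ L → boundary (shape f L) (zeros f L) p ∧ not (p ≡ᵇ (suc m + zeros f L)) ≡ f p
    atNewZero (inj₁ p<L) = trans (cong₂ _∧_ (boundary-shape f L p p<L) (cong not (≡ᵇ-false (λ p≡ → <⇒≢ p<L (trans p≡ m+z≡L)))))
      (∧-identityʳ (f p))
    atNewZero (inj₂ p≡L) = trans (cong (λ b → boundary (shape f L) (zeros f L) p ∧ not b) (≡ᵇ-true (trans p≡L (sym m+z≡L))))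
      (trans (∧-zeroʳ _) (sym (trans (cong f p≡L) fL)))
explicitBoundary : List ℕ → ℕ → ℕ → Bool
explicitBoundary la c p = not ((p <ᵇ c ∸ length la) ∨ any (λ j → p ≡ᵇ (part la j + c) ∸ j) (upFrom 1 (length la)))

explicitBoundary≡boundary : ∀ la c → length la ≤ c → ∀ p → explicitBoundary la c p ≡ boundary la c p
explicitBoundary≡boundary [] c _ p = cong not (∨-identityʳ _)
explicitBoundary≡boundary (x ∷ la) (suc c) (s≤s ℓ≤c) p = begin
  not ((p <ᵇ c ∸ length la) ∨ ((p ≡ᵇ x + suc c ∸ 1) ∨ any (λ j → p ≡ᵇ part (x ∷ la) j + suc c ∸ j) (upFrom 2 (length la))))
    ≡⟨ cong (λ b → not ((p <ᵇ c ∸ length la) ∨ ((p ≡ᵇ x + suc c ∸ 1) ∨ b))) shiftIndex ⟩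
  not ((p <ᵇ c ∸ length la) ∨ ((p ≡ᵇ x + suc c ∸ 1) ∨ any (λ j → p ≡ᵇ part la j + c ∸ j) (upFrom 1 (length la))))
    ≡⟨ not-∨-∨ (p <ᵇ c ∸ length la) (p ≡ᵇ x + suc c ∸ 1) _ ⟩
  explicitBoundary la c p ∧ not (p ≡ᵇ x + suc c ∸ 1)
    ≡⟨ cong (_∧ not (p ≡ᵇ x + suc c ∸ 1)) (explicitBoundary≡boundary la c ℓ≤c p) ⟩
  boundary la c p ∧ not (p ≡ᵇ x + suc c ∸ 1) ∎
  where
  open ≡-Reasoning
  shiftIndex : any (λ j → p ≡ᵇ (part (x ∷ la) j + suc c) ∸ j) (upFrom 2 (length la)) ≡ any (λ j → p ≡ᵇ (part la j + c) ∸ j) (upFrom 1 (length la))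
  shiftIndex = trans (cong (any _) (upFrom-suc 1 (length la))) (trans (any-map _ suc (upFrom 1 (length la)))
        (any-cong-upFrom 1 (length la) (λ { (suc j) _ _ → cong (λ k → p ≡ᵇ k ∸ suc (suc j)) (+-suc (part la (suc j)) c) })))

letter≡boundary : ∀ t la → length la ≤ t * windowM la → ∀ p → letter t la p ≡ boundary la (t * windowM la) p
letter≡boundary t la ℓ≤c p = trans (cong (λ l → not ((p <ᵇ c ∸ length la) ∨ any (λ j → p ≡ᵇ (part la j + c) ∸ j) l)) (range≡upFrom 1 (suc (length la))))
  (explicitBoundary≡boundary la c ℓ≤c p)
  where c = t * windowM la

-- Hooks divisible by t

residue : ℕ → (ℕ → Bool) → ℕ → ℕ → Bool
residue t f k X = f (t * X + k)

onesDistances-+ : ∀ f x s → onesDistances f (x + s) ≡ map (_+ s) (onesDistances f x) ++ onesDistances (λ i → f (x + i)) s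
onesDistances-+ f x zero = trans (cong (onesDistances f) (+-identityʳ x))
  (trans (sym (trans (map-cong +-identityʳ (onesDistances f x)) (map-id (onesDistances f x)))) (sym (++-identityʳ _)))
onesDistances-+ f x (suc s) = begin
  onesDistances f (x + suc s)                                                 ≡⟨ cong (onesDistances f) (+-suc x s) ⟩
  map suc (onesDistances f (x + s)) ++ lastOne                                ≡⟨ cong (λ l → map suc l ++ lastOne) (onesDistances-+ f x s) ⟩
  map suc (map (_+ s) (onesDistances f x) ++ inner s) ++ lastOne              ≡⟨ cong (_++ lastOne) (map-++ suc (map (_+ s) (onesDistances f x)) (inner s)) ⟩
  (map suc (map (_+ s) (onesDistances f x)) ++ map suc (inner s)) ++ lastOne  ≡⟨ ++-assoc (map suc (map (_+ s) (onesDistances f x))) _ _ ⟩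
  map suc (map (_+ s) (onesDistances f x)) ++ inner (suc s)                   ≡⟨ cong (_++ inner (suc s)) shiftOnce ⟩
  map (_+ suc s) (onesDistances f x) ++ inner (suc s)                         ∎
  where
  open ≡-Reasoning
  inner : ℕ → List ℕ
  inner = onesDistances (λ i → f (x + i))
  lastOne : List ℕ
  lastOne = if f (x + s) then [ 1 ] else []
  shiftOnce : map suc (map (_+ s) (onesDistances f x)) ≡ map (_+ suc s) (onesDistances f x)
  shiftOnce = trans (sym (map-∘ (onesDistances f x))) (map-cong (λ v → sym (+-suc v s)) (onesDistances f x))

onesDistances-bounds : ∀ g s → All (λ v → 1 ≤ v × v ≤ s) (onesDistances g s)
onesDistances-bounds g zero = []
onesDistances-bounds g (suc s) = AllP.++⁺ (AllP.map⁺ (All.map (λ { (1≤v , v≤s) → ≤-trans 1≤v (n≤1+n _) , s≤s v≤s }) (onesDistances-bounds g s)))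
  (lastOne (g s))
  where
  lastOne : ∀ b → All (λ v → 1 ≤ v × v ≤ suc s) (if b then [ 1 ] else [])
  lastOne true = (≤-refl , s≤s z≤n) ∷ []
  lastOne false = []

filter-∣-small : ∀ t l → All (λ v → 1 ≤ v × v < t) l → filter (t ∣?_) l ≡ []
filter-∣-small t [] _ = refl
filter-∣-small t (v ∷ l) ((1≤v , v<t) ∷ small) = trans (filter-reject (t ∣?_) t∤v) (filter-∣-small t l small)
  where
  t∤v : ¬ t ∣ v
  t∤v t∣v = <⇒≱ v<t (∣⇒≤ ⦃ >-nonZero 1≤v ⦄ t∣v)

filter-∣-+ : ∀ t l → filter (t ∣?_) (map (_+ t) l) ≡ map (_+ t) (filter (t ∣?_) l)
filter-∣-+ t [] = refl
filter-∣-+ t (v ∷ l) with t ∣? v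
... | yes t∣v = trans (filter-accept (t ∣?_) (∣m∣n⇒∣m+n t∣v ∣-refl)) (cong (v + t ∷_) (filter-∣-+ t l))
... | no t∤v = trans (filter-reject (t ∣?_) (λ t∣v+t → t∤v (∣m+n∣m⇒∣n (subst (t ∣_) (+-comm v t) t∣v+t) ∣-refl))) (filter-∣-+ t l)

filter-∣-onesDistances-period : ∀ t (g : ℕ → Bool) → 1 ≤ t → filter (t ∣?_) (onesDistances g t) ≡ (if g 0 then [ t ] else [])
filter-∣-onesDistances-period (suc s) g _ = begin
  filter (suc s ∣?_) (onesDistances g (1 + s))                                        ≡⟨ cong (filter (suc s ∣?_)) (onesDistances-+ g 1 s) ⟩
  filter (suc s ∣?_) (map (_+ s) (onesDistances g 1) ++ inner)                        ≡⟨ filter-++ (suc s ∣?_) (map (_+ s) (onesDistances g 1)) inner ⟩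
  filter (suc s ∣?_) (map (_+ s) (onesDistances g 1)) ++ filter (suc s ∣?_) inner     ≡⟨ cong₂ _++_ (first (g 0)) innerSmall ⟩
  (if g 0 then [ suc s ] else []) ++ []                                               ≡⟨ ++-identityʳ _ ⟩
  (if g 0 then [ suc s ] else [])                                                     ∎
  where
  open ≡-Reasoning
  inner : List ℕ
  inner = onesDistances (λ i → g (suc i)) s
  innerSmall : filter (suc s ∣?_) inner ≡ []
  innerSmall = filter-∣-small (suc s) inner (All.map (λ { (1≤v , v≤s) → 1≤v , s≤s v≤s }) (onesDistances-bounds (λ i → g (suc i)) s))
  first : ∀ b → filter (suc s ∣?_) (map (_+ s) (if b then [ 1 ] else [])) ≡ (if b then [ suc s ] else [])
  first true = filter-accept (suc s ∣?_) ∣-refl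
  first false = refl

filter-∣-onesDistances : ∀ t (f : ℕ → Bool) k → k < t → ∀ X →
  filter (t ∣?_) (onesDistances f (t * X + k)) ≡ map (t *_) (onesDistances (residue t f k) X)
filter-∣-onesDistances t f k k<t zero = filter-∣-small t (onesDistances f (t * 0 + k))
  (All.map (λ { (1≤v , v≤k) → 1≤v , ≤-<-trans v≤k (subst (_< t) (sym (cong (_+ k) (*-zeroʳ t))) k<t) }) (onesDistances-bounds f (t * 0 + k)))
filter-∣-onesDistances t f k k<t (suc X) = begin
  filter (t ∣?_) (onesDistances f (t * suc X + k))                                      ≡⟨ cong (λ y → filter (t ∣?_) (onesDistances f y)) onePeriodLater ⟩
  filter (t ∣?_) (onesDistances f (x + t))                                              ≡⟨ cong (filter (t ∣?_)) (onesDistances-+ f x t) ⟩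
  filter (t ∣?_) (map (_+ t) (onesDistances f x) ++ inner)                              ≡⟨ filter-++ (t ∣?_) (map (_+ t) (onesDistances f x)) inner ⟩
  filter (t ∣?_) (map (_+ t) (onesDistances f x)) ++ filter (t ∣?_) inner               ≡⟨ cong₂ _++_ earlier lastPeriod ⟩
  map (t *_) (map suc (onesDistances r X)) ++ (if r X then [ t ] else [])               ≡⟨ cong (map (t *_) (map suc (onesDistances r X)) ++_) (scaleOne (r X)) ⟨
  map (t *_) (map suc (onesDistances r X)) ++ map (t *_) (if r X then [ 1 ] else [])    ≡⟨ map-++ (t *_) (map suc (onesDistances r X)) _ ⟨
  map (t *_) (onesDistances r (suc X))                                                  ∎
  where
  open ≡-Reasoning
  x = t * X + k
  r = residue t f k
  inner = onesDistances (λ i → f (x + i)) t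
  onePeriodLater : t * suc X + k ≡ x + t
  onePeriodLater = trans (cong (_+ k) (*-suc t X)) (trans (+-assoc t (t * X) k) (+-comm t x))
  earlier : filter (t ∣?_) (map (_+ t) (onesDistances f x)) ≡ map (t *_) (map suc (onesDistances r X))
  earlier = trans (filter-∣-+ t (onesDistances f x)) (trans (cong (map (_+ t)) (filter-∣-onesDistances t f k k<t X))
    (trans (sym (map-∘ (onesDistances r X))) (trans (map-cong (λ v → trans (+-comm (t * v) t) (sym (*-suc t v))) (onesDistances r X)) (map-∘ (onesDistances r X)))))
  lastPeriod : filter (t ∣?_) inner ≡ (if r X then [ t ] else [])
  lastPeriod = trans (filter-∣-onesDistances-period t (λ i → f (x + i)) (≤-<-trans z≤n k<t)) (cong (λ y → if f y then [ t ] else []) (+-identityʳ x))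
  scaleOne : ∀ b → map (t *_) (if b then [ 1 ] else []) ≡ (if b then [ t ] else [])
  scaleOne true = cong [_] (*-identityʳ t)
  scaleOne false = refl

filter-∣-hooksEndingAt : ∀ t (f : ℕ → Bool) K k → k < t →
  filter (t ∣?_) (hooksEndingAt f (t * K + k)) ≡ map (t *_) (hooksEndingAt (residue t f k) K)
filter-∣-hooksEndingAt t f K k k<t with f (t * K + k)
... | true = refl
... | false = filter-∣-onesDistances t f k k<t K

wordHooks-+ : ∀ f x s → wordHooks f (x + s) ≡ concatMap (λ i → hooksEndingAt f (x + i)) (downFrom s) ++ wordHooks f x
wordHooks-+ f x zero = cong (wordHooks f) (+-identityʳ x)
wordHooks-+ f x (suc s) = trans (cong (wordHooks f) (+-suc x s))
  (trans (cong (hooksEndingAt f (x + s) ++_) (wordHooks-+ f x s)) (sym (++-assoc (hooksEndingAt f (x + s)) _ _)))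

concatMap-downFrom↭upTo : ∀ {A : Set} (a : ℕ → List A) s → concatMap a (downFrom s) ↭ concatMap a (upTo s)
concatMap-downFrom↭upTo a zero = ↭-refl
concatMap-downFrom↭upTo a (suc s) = ↭-trans (↭-++-comm (a s) (concatMap a (downFrom s))) (↭-trans (++⁺ʳ (a s) (concatMap-downFrom↭upTo a s))
  (↭-reflexive (sym (trans (cong (concatMap a) (upTo-suc s)) (trans (concatMap-++ a (upTo s) [ s ]) (cong (concatMap a (upTo s) ++_) (++-identityʳ (a s))))))))

concatMap-++-↭ : ∀ {A : Set} (a b : A → List ℕ) xs → concatMap (λ k → a k ++ b k) xs ↭ concatMap a xs ++ concatMap b xs
concatMap-++-↭ a b [] = ↭-refl
concatMap-++-↭ a b (x ∷ xs) = ↭-trans (↭-reflexive (++-assoc (a x) (b x) _)) (↭-trans (++⁺ˡ (a x) (↭-trans (++⁺ˡ (b x) (concatMap-++-↭ a b xs))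
  (↭-trans (↭-reflexive (sym (++-assoc (b x) _ _))) (↭-trans (++⁺ʳ (concatMap b xs) (↭-++-comm (b x) (concatMap a xs))) (↭-reflexive (++-assoc (concatMap a xs) (b x) _))))))
  (↭-reflexive (sym (++-assoc (a x) _ _))))

filter-∣-lastPeriod : ∀ t (f : ℕ → Bool) K s → s ≤ t →
  filter (t ∣?_) (concatMap (λ i → hooksEndingAt f (t * K + i)) (downFrom s)) ≡
  concatMap (λ k → map (t *_) (hooksEndingAt (residue t f k) K)) (downFrom s)
filter-∣-lastPeriod t f K zero _ = refl
filter-∣-lastPeriod t f K (suc s) s<t = trans (filter-++ (t ∣?_) (hooksEndingAt f (t * K + s)) _)
  (cong₂ _++_ (filter-∣-hooksEndingAt t f K s s<t) (filter-∣-lastPeriod t f K s (<⇒≤ s<t)))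

filter-∣-wordHooks : ∀ t (f : ℕ → Bool) K →
  filter (t ∣?_) (wordHooks f (t * K)) ↭ concatMap (λ k → map (t *_) (wordHooks (residue t f k) K)) (upTo t)
filter-∣-wordHooks t f zero = ↭-reflexive (trans (cong (λ y → filter (t ∣?_) (wordHooks f y)) (*-zeroʳ t)) (sym (concatMap-[] (upTo t))))
  where
  concatMap-[] : ∀ (xs : List ℕ) → concatMap (λ k → map (t *_) (wordHooks (residue t f k) zero)) xs ≡ []
  concatMap-[] [] = refl
  concatMap-[] (x ∷ xs) = concatMap-[] xs
filter-∣-wordHooks t f (suc K) = begin
  filter (t ∣?_) (wordHooks f (t * suc K))                                     ≡⟨ cong (λ y → filter (t ∣?_) (wordHooks f y)) (trans (*-suc t K) (+-comm t (t * K))) ⟩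
  filter (t ∣?_) (wordHooks f (t * K + t))                                     ≡⟨ cong (filter (t ∣?_)) (wordHooks-+ f (t * K) t) ⟩
  filter (t ∣?_) (concatMap (λ i → hooksEndingAt f (t * K + i)) (downFrom t) ++ wordHooks f (t * K))
    ≡⟨ filter-++ (t ∣?_) (concatMap (λ i → hooksEndingAt f (t * K + i)) (downFrom t)) (wordHooks f (t * K)) ⟩
  filter (t ∣?_) (concatMap (λ i → hooksEndingAt f (t * K + i)) (downFrom t)) ++ filter (t ∣?_) (wordHooks f (t * K))
    ≡⟨ cong (_++ filter (t ∣?_) (wordHooks f (t * K))) (filter-∣-lastPeriod t f K t ≤-refl) ⟩
  concatMap newest (downFrom t) ++ filter (t ∣?_) (wordHooks f (t * K))      ↭⟨ ++⁺ (concatMap-downFrom↭upTo newest t) (filter-∣-wordHooks t f K) ⟩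
  concatMap newest (upTo t) ++ concatMap older (upTo t)                        ↭⟨ concatMap-++-↭ newest older (upTo t) ⟨
  concatMap (λ k → newest k ++ older k) (upTo t)                               ≡⟨ cong concat (map-cong (λ k → sym (map-++ (t *_) (hooksEndingAt (residue t f k) K) _)) (upTo t)) ⟩
  concatMap (λ k → map (t *_) (wordHooks (residue t f k) (suc K))) (upTo t)   ∎
  where
  open PermutationReasoning
  newest older : ℕ → List ℕ
  newest k = map (t *_) (hooksEndingAt (residue t f k) K)
  older k = map (t *_) (wordHooks (residue t f k) K)

filter-∣≡[]⇒noneDivisible : ∀ t l → filter (t ∣?_) l ≡ [] → NoneDivisible t l
filter-∣≡[]⇒noneDivisible t [] _ = nd-[]
filter-∣≡[]⇒noneDivisible t (x ∷ l) none with t ∣? x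
... | yes _ with () ← none
... | no t∤x = nd-∷ t∤x (filter-∣≡[]⇒noneDivisible t l none)

-- Durfee square and Frobenius coordinates

StrictlyDecreasing : ℕ → (ℕ → ℕ) → Set
StrictlyDecreasing d A = ∀ i j → 1 ≤ i → i < j → j ≤ d → A j < A i

Covers : ℕ → (ℕ → ℕ) → (ℕ → ℕ) → Set
Covers d A B = ∀ i → 1 ≤ i → i ≤ d → Σ ℕ λ k → 1 ≤ k × k ≤ d × A i ≡ B k

covers⇒≤ : ∀ d (A B : ℕ → ℕ) → StrictlyDecreasing d A → StrictlyDecreasing d B → Covers d A B →
  ∀ i → 1 ≤ i → i ≤ d → (∀ k → 1 ≤ k → k < i → A k ≡ B k) → A i ≤ B i
covers⇒≤ d A B A↓ B↓ A⊆B i 1≤i i≤d agreeBelow with A⊆B i 1≤i i≤d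
... | k , 1≤k , k≤d , Ai≡Bk with <-cmp k i
... | tri< k<i _ _ = ⊥-elim (<-irrefl (trans Ai≡Bk (sym (agreeBelow k 1≤k k<i))) (A↓ k i 1≤k k<i i≤d))
... | tri≈ _ refl _ = ≤-reflexive Ai≡Bk
... | tri> _ _ i<k = ≤-trans (≤-reflexive Ai≡Bk) (<⇒≤ (B↓ i k 1≤i i<k k≤d))

strictlyDecreasing-covers⇒≡ : ∀ d (A B : ℕ → ℕ) → StrictlyDecreasing d A → StrictlyDecreasing d B → Covers d A B → Covers d B A →
  ∀ i → 1 ≤ i → i ≤ d → A i ≡ B i
strictlyDecreasing-covers⇒≡ d A B A↓ B↓ A⊆B B⊆A i = below (suc i) i ≤-refl
  where
  below : ∀ n i → i < n → 1 ≤ i → i ≤ d → A i ≡ B i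
  below (suc n) i i<n 1≤i i≤d =
    ≤-antisym (covers⇒≤ d A B A↓ B↓ A⊆B i 1≤i i≤d agree) (covers⇒≤ d B A B↓ A↓ B⊆A i 1≤i i≤d (λ k 1≤k k<i → sym (agree k 1≤k k<i)))
    where
    agree : ∀ k → 1 ≤ k → k < i → A k ≡ B k
    agree k 1≤k k<i = below n k (≤-trans k<i (≤-pred i<n)) 1≤k (≤-trans (<⇒≤ k<i) i≤d)

onDiagonal : List ℕ → ℕ → Bool
onDiagonal la i = suc i ≤ᵇ part la (suc i)

durfee-upFrom : ∀ la a n → length (filter (λ s → s ≤? part la s) (upFrom a n)) ≡ count n (λ i → a + i ≤ᵇ part la (a + i))
durfee-upFrom la a zero = refl
durfee-upFrom la a (suc n) with a ≤? part la a
... | yes a≤ = trans (cong length (filter-accept (λ s → s ≤? part la s) a≤))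
  (sym (trans (count-suc-upFrom n a diagonal) (cong₂ _+_ (cong bit (≤ᵇ-true a≤)) (sym (durfee-upFrom la (suc a) n)))))
  where
  diagonal : ℕ → Bool
  diagonal k = k ≤ᵇ part la k
... | no a≰ = trans (cong length (filter-reject (λ s → s ≤? part la s) a≰))
  (sym (trans (count-suc-upFrom n a diagonal) (cong₂ _+_ (cong bit (≤ᵇ-false (≰⇒> a≰))) (sym (durfee-upFrom la (suc a) n)))))
  where
  diagonal : ℕ → Bool
  diagonal k = k ≤ᵇ part la k

durfee≡count : ∀ la n → length la ≤ n → durfee la ≡ count n (onDiagonal la)
durfee≡count la n ℓ≤n = begin
  durfee la                                                                  ≡⟨ cong (λ l → length (filter (λ s → s ≤? part la s) l)) (range≡upFrom 1 (suc ℓ)) ⟩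
  length (filter (λ s → s ≤? part la s) (upFrom 1 ℓ))                        ≡⟨ durfee-upFrom la 1 ℓ ⟩
  count ℓ (onDiagonal la)                                                    ≡⟨ +-identityʳ _ ⟨
  count ℓ (onDiagonal la) + 0                                                ≡⟨ cong (count ℓ (onDiagonal la) +_) (Σ<-zero (n ∸ ℓ) offDiagonal) ⟨
  count ℓ (onDiagonal la) + Σ< (n ∸ ℓ) (λ i → bit (onDiagonal la (ℓ + i)))  ≡⟨ Σ<-split ℓ (n ∸ ℓ) (λ i → bit (onDiagonal la i)) ⟨
  count (ℓ + (n ∸ ℓ)) (onDiagonal la)                                        ≡⟨ cong (λ k → count k (onDiagonal la)) (m+[n∸m]≡n ℓ≤n) ⟩
  count n (onDiagonal la)                                                    ∎
  where
  open ≡-Reasoning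
  ℓ = length la
  offDiagonal : ∀ i → i < n ∸ ℓ → bit (onDiagonal la (ℓ + i)) ≡ 0
  offDiagonal i _ = cong (λ k → bit (suc (ℓ + i) ≤ᵇ k)) (part-beyondLength la (ℓ + i) (m≤m+n ℓ i))

downClosed-≤ : ∀ (h : ℕ → Bool) → (∀ i → h (suc i) ≡ true → h i ≡ true) → ∀ {a b} → a ≤ b → h b ≡ true → h a ≡ true
downClosed-≤ h downClosed {b = zero} z≤n hb = hb
downClosed-≤ h downClosed {a} {suc b} a≤1+b hb with m≤n⇒m<n∨m≡n a≤1+b
... | inj₁ a<1+b = downClosed-≤ h downClosed (≤-pred a<1+b) (downClosed b hb)
... | inj₂ refl = hb

count-downClosed : ∀ (h : ℕ → Bool) → (∀ i → h (suc i) ≡ true → h i ≡ true) →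
  ∀ n j → j < n → (h j ≡ true → j < count n h) × (j < count n h → h j ≡ true)
count-downClosed h downClosed (suc n) j j<1+n with h n in hn
... | true = (λ _ → subst (j <_) (sym allBelow) j<1+n) , (λ _ → downClosed-≤ h downClosed (≤-pred j<1+n) hn)
  where
  allBelow : count n h + 1 ≡ suc n
  allBelow = trans (cong (_+ 1) (count-all n (λ i i<n → downClosed-≤ h downClosed (<⇒≤ i<n) hn))) (+-comm n 1)
... | false with m≤n⇒m<n∨m≡n (≤-pred j<1+n)
...   | inj₁ j<n = (λ hj → subst (j <_) (sym (+-identityʳ _)) (proj₁ ih hj)) , (λ j< → proj₂ ih (subst (j <_) (+-identityʳ _) j<))
  where ih = count-downClosed h downClosed n j j<n
...   | inj₂ refl = (λ hj → ⊥-elim (true≢false (trans (sym hj) hn))) , (λ j< → ⊥-elim (<⇒≱ (subst (j <_) (+-identityʳ _) j<) (count≤ j h)))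

≤durfee⇔onDiagonal : ∀ {la} → Decreasing la → ∀ i → (suc i ≤ durfee la → suc i ≤ part la (suc i)) × (suc i ≤ part la (suc i) → suc i ≤ durfee la)
≤durfee⇔onDiagonal {la} d i = (λ i<durfee → ≤ᵇ-true⁻¹ (proj₂ diagonal (subst (i <_) durfee≡ i<durfee))) ,
                               (λ onDiag → subst (i <_) (sym durfee≡) (proj₁ diagonal (≤ᵇ-true onDiag)))
  where
  n = length la + suc i
  durfee≡ : durfee la ≡ count n (onDiagonal la)
  durfee≡ = durfee≡count la n (m≤m+n _ _)
  downClosed : ∀ i → onDiagonal la (suc i) ≡ true → onDiagonal la i ≡ true
  downClosed i e = ≤ᵇ-true (≤-trans (n≤1+n (suc i)) (≤-trans (≤ᵇ-true⁻¹ e) (part-suc≤part d i)))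
  diagonal : (onDiagonal la i ≡ true → i < count n (onDiagonal la)) × (i < count n (onDiagonal la) → onDiagonal la i ≡ true)
  diagonal = count-downClosed (onDiagonal la) downClosed n i (m≤n+m (suc i) (length la))

durfee-conj : ∀ {la} → IsPartition la → durfee (conj la) ≡ durfee la
durfee-conj {la} (d , _) = trans (durfee≡count (conj la) n (≤-trans (≤-reflexive (length-conj la)) (m≤m+n _ _)))
  (trans (count-cong n sameDiagonal) (sym (durfee≡count la n (m≤n+m _ _))))
  where
  n = part la 1 + length la
  sameDiagonal : ∀ i → i < n → onDiagonal (conj la) i ≡ onDiagonal la i
  sameDiagonal i _ with suc i ≤? part la 1
  ... | yes i<λ₁ = trans (cong (suc i ≤ᵇ_) (part-conj la i i<λ₁)) (≤ᵇ-atLeast d (suc i) (suc i) (s≤s z≤n) (s≤s z≤n))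
  ... | no i≮λ₁ = trans (cong (suc i ≤ᵇ_) (part-beyondLength (conj la) i (≤-trans (≤-reflexive (length-conj la)) (≤-pred (≰⇒> i≮λ₁)))))
    (sym (≤ᵇ-false (≤-<-trans (part≤head d i) (≰⇒> i≮λ₁))))

frobα-strictlyDecreasing : ∀ {la} → IsPartition la → StrictlyDecreasing (durfee la) (frobα la)
frobα-strictlyDecreasing {la} (d , _) (suc i) (suc j) _ i<j j≤d = m+n≤o⇒m≤o∸n (suc a) (begin
  suc a + suc i       ≡⟨ +-suc a (suc i) ⟨
  a + suc (suc i)     ≤⟨ +-monoʳ-≤ a i<j ⟩
  a + suc j           ≡⟨ m∸n+n≡m (proj₁ (≤durfee⇔onDiagonal d j) j≤d) ⟩
  part la (suc j)     ≤⟨ part-anti d (≤-pred (<⇒≤ i<j)) ⟩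
  part la (suc i)     ∎)
  where
  open ≤-Reasoning
  a = frobα la (suc j)

frobα< : ∀ {la} → IsPartition la → ∀ c → part la 1 ≤ c → ∀ i → 1 ≤ i → i ≤ durfee la → frobα la i < c
frobα< {la} (d , _) c λ₁≤c (suc i) _ i≤d = ≤-trans (∸-suc< (≤-trans (s≤s z≤n) onDiag)) (≤-trans (part≤head d i) λ₁≤c)
  where
  onDiag : suc i ≤ part la (suc i)
  onDiag = proj₁ (≤durfee⇔onDiagonal d i) i≤d
  ∸-suc< : ∀ {a} → 1 ≤ a → a ∸ suc i < a
  ∸-suc< {suc a} _ = s≤s (m∸n≤m a i)

IsFrobα IsFrobβ : List ℕ → ℕ → Set
IsFrobα la x = Σ ℕ λ i → 1 ≤ i × i ≤ durfee la × x ≡ frobα la i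
IsFrobβ la y = Σ ℕ λ i → 1 ≤ i × i ≤ durfee la × y ≡ frobβ la i

+∸< : ∀ {a j c} → a < j → j < suc c → a + c ∸ j < c
+∸< {a} {j} {c} a<j (s≤s j≤c) = +-cancelʳ-< j _ _ (subst (_< c + j) (sym (m∸n+n≡m (≤-trans j≤c (m≤n+m c a)))) (subst (a + c <_) (+-comm j c) (+-monoˡ-< c a<j)))

not-false∨ : ∀ {b} → not (false ∨ b) ≡ false → b ≡ true
not-false∨ {true} _ = refl

module _ {la : List ℕ} (ip : IsPartition la) (c : ℕ) (ℓ≤c : length la ≤ c) where

  private
    zeroAt : ℕ → ℕ → Bool
    zeroAt x j = c + x ≡ᵇ part la j + c ∸ j
    notBeforeStart : ∀ x → (c + x <ᵇ c ∸ length la) ≡ false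
    notBeforeStart x = <ᵇ-false (≤-trans (m∸n≤m c (length la)) (m≤m+n c x))

  boundary-false⇒frobα : ∀ x → boundary la c (c + x) ≡ false → IsFrobα la x
  boundary-false⇒frobα x isZero with any≡true⇒∃ (zeroAt x) 1 (length la) hit
    where
    hit : any (zeroAt x) (upFrom 1 (length la)) ≡ true
    hit = not-false∨ (trans (cong (λ b → not (b ∨ any (zeroAt x) (upFrom 1 (length la)))) (sym (notBeforeStart x)))
      (trans (explicitBoundary≡boundary la c ℓ≤c (c + x)) isZero))
  ... | suc i , _ , i<1+ℓ , atZero = suc i , s≤s z≤n , proj₂ (≤durfee⇔onDiagonal (proj₁ ip) i) onDiagonal′ , x≡α
    where
    position : c + x ≡ part la (suc i) + c ∸ suc i
    position = ≡ᵇ-true⁻¹ atZero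
    onDiagonal′ : suc i ≤ part la (suc i)
    onDiagonal′ with suc i ≤? part la (suc i)
    ... | yes on = on
    ... | no off = ⊥-elim (<⇒≱ (≤-trans (+∸< (≰⇒> off) (≤-trans i<1+ℓ (s≤s ℓ≤c))) (m≤m+n c x)) (≤-reflexive position))
    x≡α : x ≡ frobα la (suc i)
    x≡α = +-cancelˡ-≡ c _ _ (trans position (trans (+-∸-comm c onDiagonal′) (+-comm _ c)))

  frobα⇒boundary-false : ∀ x → IsFrobα la x → boundary la c (c + x) ≡ false
  frobα⇒boundary-false x (suc i , _ , i≤d , x≡α) = trans (sym (explicitBoundary≡boundary la c ℓ≤c (c + x)))
    (cong not (trans (cong (_∨ any (zeroAt x) (upFrom 1 (length la))) (notBeforeStart x)) hit))
    where
    onDiagonal′ : suc i ≤ part la (suc i)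
    onDiagonal′ = proj₁ (≤durfee⇔onDiagonal (proj₁ ip) i) i≤d
    i<1+ℓ : suc i < 1 + length la
    i<1+ℓ with suc i ≤? length la
    ... | yes i<ℓ = s≤s i<ℓ
    ... | no i≮ℓ = ⊥-elim (<⇒≱ (s≤s z≤n) (≤-trans onDiagonal′ (≤-reflexive (part-beyondLength la i (≤-pred (≰⇒> i≮ℓ))))))
    hit : any (zeroAt x) (upFrom 1 (length la)) ≡ true
    hit = ∃⇒any≡true (zeroAt x) 1 (length la) (suc i) (s≤s z≤n) i<1+ℓ
      (≡ᵇ-true (trans (cong (c +_) x≡α) (trans (+-comm c _) (sym (+-∸-comm c onDiagonal′)))))

boundary-conj : ∀ {la} → IsPartition la → ∀ c → length la ≤ c → part la 1 ≤ c → ∀ q → q < c + c →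
  boundary (conj la) c q ≡ not (boundary la c (c + c ∸ suc q))
boundary-conj {la} ip c ℓ≤c λ₁≤c q q<2c = trans (cong₂ (λ l m → boundary l m q) (sym shape≡) (sym zeros≡)) (boundary-shape (reflect g (c + c)) (c + c) q q<2c)
  where
  g = boundary la c
  shape-boundary-la : shape g (c + c) ≡ la × zeros g (c + c) ≡ c
  shape-boundary-la = shape-boundary la ip c ℓ≤c (c + c) (+-monoʳ-≤ c λ₁≤c)
  shape≡ : shape (reflect g (c + c)) (c + c) ≡ conj la
  shape≡ = trans (shape-reflect g (c + c)) (cong conj (proj₁ shape-boundary-la))
  zeros≡ : zeros (reflect g (c + c)) (c + c) ≡ c
  zeros≡ = trans (zeros-reflect g (c + c)) (+-cancelʳ-≡ c _ _ (trans (cong (ones g (c + c) +_) (sym (proj₂ shape-boundary-la))) (ones+zeros g (c + c))))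

module _ {la : List ℕ} (ip : IsPartition la) (c : ℕ) (ℓ≤c : length la ≤ c) (λ₁≤c : part la 1 ≤ c) where

  private
    conj-fits : length (conj la) ≤ c
    conj-fits = ≤-trans (≤-reflexive (length-conj la)) λ₁≤c
    mirrored : ∀ y → y < c → c + c ∸ suc (c + y) ≡ c ∸ suc y
    mirrored y y<c = trans (cong (c + c ∸_) (sym (+-suc c y))) ([m+n]∸[m+o]≡n∸o c c (suc y))
    conj-boundary : ∀ y → y < c → boundary (conj la) c (c + y) ≡ not (boundary la c (c ∸ suc y))
    conj-boundary y y<c = trans (boundary-conj ip c ℓ≤c λ₁≤c (c + y) (+-monoʳ-< c y<c)) (cong (λ p → not (boundary la c p)) (mirrored y y<c))

  boundary-true⇒frobβ : ∀ y → y < c → boundary la c (c ∸ suc y) ≡ true → IsFrobβ la y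
  boundary-true⇒frobβ y y<c isOne =
    let (i , 1≤i , i≤d , y≡β) = boundary-false⇒frobα (conj-isPartition ip) c conj-fits y (trans (conj-boundary y y<c) (cong not isOne))
    in i , 1≤i , subst (i ≤_) (durfee-conj ip) i≤d , y≡β

  frobβ⇒boundary-true : ∀ y → y < c → IsFrobβ la y → boundary la c (c ∸ suc y) ≡ true
  frobβ⇒boundary-true y y<c (i , 1≤i , i≤d , y≡β) = trans (sym (not-involutive _)) (cong not (trans (sym (conj-boundary y y<c))
    (frobα⇒boundary-false (conj-isPartition ip) c conj-fits y (i , 1≤i , subst (i ≤_) (sym (durfee-conj ip)) i≤d , y≡β))))

-- The Littlewood decomposition

module _ (t : ℕ) .{{_ : NonZero t}} where

  divmod-affine : ∀ X k → k < t → ((t * X + k) / t ≡ X) × ((t * X + k) % t ≡ k)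
  divmod-affine X k k<t = quotient≡ , remainder≡
    where
    swapped : t * X + k ≡ k + X * t
    swapped = trans (+-comm (t * X) k) (cong (k +_) (*-comm t X))
    k%t<t : k % t + X * t % t < t
    k%t<t = subst (_< t) (sym (trans (cong₂ _+_ (m<n⇒m%n≡m k<t) (m*n%n≡0 X t)) (+-identityʳ k))) k<t
    quotient≡ : (t * X + k) / t ≡ X
    quotient≡ = trans (/-congˡ swapped) (trans (+-distrib-/ k (X * t) k%t<t) (cong₂ _+_ (m<n⇒m/n≡0 k<t) (m*n/n≡m X t)))
    remainder≡ : (t * X + k) % t ≡ k
    remainder≡ = trans (%-congˡ swapped) (trans ([m+kn]%n≡m%n k X t) (m<n⇒m%n≡m k<t))

  ≡t*[m/t]+m%t : ∀ p → p ≡ t * (p / t) + p % t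
  ≡t*[m/t]+m%t p = trans (m≡m%n+[m/n]*n p t) (trans (+-comm (p % t) _) (cong (_+ p % t) (*-comm (p / t) t)))

  t*+-injective : ∀ a b u v → t * a + u ≡ t * b + v → u < t → v < t → a ≡ b × u ≡ v
  t*+-injective a b u v e u<t v<t =
    trans (sym (proj₁ (divmod-affine a u u<t))) (trans (cong (_/ t) e) (proj₁ (divmod-affine b v v<t))) ,
    trans (sym (proj₂ (divmod-affine a u u<t))) (trans (cong (_% t) e) (proj₂ (divmod-affine b v v<t)))

  t*+<t* : ∀ {r X Y} → r < t → X < Y → t * X + r < t * Y
  t*+<t* {r} {X} r<t X<Y = ≤-trans (+-monoʳ-< (t * X) r<t) (≤-trans (≤-reflexive (trans (+-comm (t * X) t) (sym (*-suc t X)))) (*-monoʳ-≤ t X<Y))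

  t*+<t*⁻¹ : ∀ {r X Y} → t * X + r < t * Y → X < Y
  t*+<t*⁻¹ {r} {X} {Y} lt with X <? Y
  ... | yes X<Y = X<Y
  ... | no X≮Y = ⊥-elim (<⇒≱ lt (≤-trans (*-monoʳ-≤ t (≮⇒≥ X≮Y)) (m≤m+n (t * X) r)))

  t*+≥t*+⁻¹ : ∀ {r X Y z} → r < z → t * Y + z ≤ t * X + r → Y < X
  t*+≥t*+⁻¹ {r} {X} {Y} {z} r<z le with Y <? X
  ... | yes Y<X = Y<X
  ... | no Y≮X = ⊥-elim (<⇒≱ (≤-<-trans (+-monoˡ-≤ r (*-monoʳ-≤ t (≮⇒≥ Y≮X))) (+-monoʳ-< (t * Y) r<z)) le)

  concatMap-blocks : ∀ {A : Set} (h : ℕ → ℕ → A) K →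
    concatMap (λ q → map (h q) (upTo t)) (upTo K) ≡ map (λ p → h (p / t) (p % t)) (upTo (t * K))
  concatMap-blocks h zero = cong (λ k → map (λ p → h (p / t) (p % t)) (upTo k)) (sym (*-zeroʳ t))
  concatMap-blocks h (suc K) = begin
    concatMap (λ q → map (h q) (upTo t)) (upTo (suc K))               ≡⟨ cong (concatMap (λ q → map (h q) (upTo t))) (upTo-suc K) ⟩
    concatMap (λ q → map (h q) (upTo t)) (upTo K ++ [ K ])            ≡⟨ concatMap-++ (λ q → map (h q) (upTo t)) (upTo K) [ K ] ⟩
    concatMap (λ q → map (h q) (upTo t)) (upTo K) ++ (map (h K) (upTo t) ++ [])
      ≡⟨ cong₂ _++_ (concatMap-blocks h K) (trans (++-identityʳ _) (map-upTo-cong t lastBlock)) ⟩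
    map g (upTo (t * K)) ++ map (λ i → g (t * K + i)) (upTo t)         ≡⟨ map-upTo-+ g (t * K) t ⟨
    map g (upTo (t * K + t))                                           ≡⟨ cong (λ k → map g (upTo k)) (trans (+-comm (t * K) t) (sym (*-suc t K))) ⟩
    map g (upTo (t * suc K))                                           ∎
    where
    open ≡-Reasoning
    g = λ p → h (p / t) (p % t)
    lastBlock : ∀ i → i < t → h K i ≡ g (t * K + i)
    lastBlock i i<t = sym (cong₂ h (proj₁ (divmod-affine K i i<t)) (proj₂ (divmod-affine K i i<t)))

countFalse-map-upTo : ∀ f L → length (filter (_≟ᵇ false) (map f (upTo L))) ≡ zeros f L
countFalse-map-upTo f zero = refl
countFalse-map-upTo f (suc L) = begin
  length (filter (_≟ᵇ false) (map f (upTo (suc L))))                           ≡⟨ cong (λ l → length (filter (_≟ᵇ false) l)) (map-upTo-suc f L) ⟩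
  length (filter (_≟ᵇ false) (map f (upTo L) ++ [ f L ]))                      ≡⟨ cong length (filter-++ (_≟ᵇ false) (map f (upTo L)) [ f L ]) ⟩
  length (filter (_≟ᵇ false) (map f (upTo L)) ++ filter (_≟ᵇ false) [ f L ])   ≡⟨ length-++ (filter (_≟ᵇ false) (map f (upTo L))) ⟩
  length (filter (_≟ᵇ false) (map f (upTo L))) + length (filter (_≟ᵇ false) [ f L ]) ≡⟨ cong₂ _+_ (countFalse-map-upTo f L) (lastLetter (f L)) ⟩
  zeros f L + bit (not (f L))                                                  ∎
  where
  open ≡-Reasoning
  lastLetter : ∀ b → length (filter (_≟ᵇ false) [ b ]) ≡ bit (not b)
  lastLetter true = refl
  lastLetter false = refl

zeros-residues : ∀ t K f → zeros f (t * K) ≡ Σ< t (λ k → zeros (residue t f k) K)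
zeros-residues t K f = trans (Σ<-blocks t K (λ p → bit (not (f p)))) (Σ<-swap K t (λ X k → bit (not (f (t * X + k)))))

zeroPositionSum-residues : ∀ t K f →
  zeroPositionSum f (t * K) ≡ Σ< t (λ k → t * zeroPositionSum (residue t f k) K + k * zeros (residue t f k) K)
zeroPositionSum-residues t K f =
  trans (Σ<-blocks t K (λ p → bit (not (f p)) * p)) (trans (Σ<-swap K t (λ X k → zeroAt X k * (t * X + k))) (Σ<-cong t (λ k _ → class k)))
  where
  zeroAt : ℕ → ℕ → ℕ
  zeroAt X k = bit (not (f (t * X + k)))
  expand : ∀ b t X k → b * (t * X + k) ≡ t * (b * X) + k * b
  expand = solve-∀
  class : ∀ k → Σ< K (λ X → zeroAt X k * (t * X + k)) ≡ t * zeroPositionSum (residue t f k) K + k * zeros (residue t f k) K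
  class k = trans (Σ<-cong K (λ X _ → expand (zeroAt X k) t X k))
    (trans (Σ<-+ K (λ X → t * (zeroAt X k * X)) (λ X → k * zeroAt X k))
      (cong₂ _+_ (Σ<-* K t (λ X → zeroAt X k * X)) (Σ<-* K k (λ X → zeroAt X k))))

size-residues : ∀ t K f → size (shape f (t * K)) + triangle (zeros f (t * K)) ≡
  Σ< t (λ k → t * (size (shape (residue t f k) K) + triangle (zeros (residue t f k) K)) + k * zeros (residue t f k) K)
size-residues t K f = trans (size-shape f (t * K)) (trans (zeroPositionSum-residues t K f)
  (Σ<-cong t (λ k _ → cong (λ v → t * v + k * zeros (residue t f k) K) (sym (size-shape (residue t f k) K)))))

size-shape-residues : ∀ t K f h → (∀ k → k < t → zeros (residue t h k) K ≡ zeros (residue t f k) K) →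
  (∀ k → k < t → size (shape (residue t h k) K) ≡ 0) →
  size (shape f (t * K)) ≡ size (shape h (t * K)) + t * Σ< t (λ k → size (shape (residue t f k) K))
size-shape-residues t K f h sameZeros emptyShapes = +-cancelʳ-≡ (triangle (zeros f (t * K))) _ _ (begin
  size (shape f (t * K)) + triangle (zeros f (t * K))                  ≡⟨ size-residues t K f ⟩
  Σ< t (λ k → t * (s k + triangle (n k)) + k * n k)                     ≡⟨ Σ<-cong t (λ k _ → regroup t (s k) (triangle (n k)) (k * n k)) ⟩
  Σ< t (λ k → t * s k + rest k)                                         ≡⟨ Σ<-+ t (λ k → t * s k) rest ⟩
  Σ< t (λ k → t * s k) + Σ< t rest                                      ≡⟨ cong₂ _+_ (Σ<-* t t s) (sym coreSide) ⟩
  t * Σ< t s + (size (shape h (t * K)) + triangle (zeros h (t * K)))    ≡⟨ cong (λ m → t * Σ< t s + (size (shape h (t * K)) + triangle m)) sameTotal ⟩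
  t * Σ< t s + (size (shape h (t * K)) + triangle (zeros f (t * K)))    ≡⟨ swap (t * Σ< t s) (size (shape h (t * K))) (triangle (zeros f (t * K))) ⟩
  size (shape h (t * K)) + t * Σ< t s + triangle (zeros f (t * K))      ∎)
  where
  open ≡-Reasoning
  s n : ℕ → ℕ
  s k = size (shape (residue t f k) K)
  n k = zeros (residue t f k) K
  rest : ℕ → ℕ
  rest k = t * triangle (n k) + k * n k
  regroup : ∀ t a b c → t * (a + b) + c ≡ t * a + (t * b + c)
  regroup = solve-∀
  swap : ∀ a b c → a + (b + c) ≡ b + a + c
  swap = solve-∀
  coreSide : size (shape h (t * K)) + triangle (zeros h (t * K)) ≡ Σ< t rest
  coreSide = trans (size-residues t K h) (Σ<-cong t (λ k k<t → cong₂ (λ a b → t * (a + triangle b) + k * b) (emptyShapes k k<t) (sameZeros k k<t)))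
  sameTotal : zeros h (t * K) ≡ zeros f (t * K)
  sameTotal = trans (zeros-residues t K h) (trans (Σ<-cong t sameZeros) (sym (zeros-residues t K f)))

module LittlewoodDecomposition (t : ℕ) .{{_ : NonZero t}} {la : List ℕ} (ip : IsPartition la) where

  M c K : ℕ
  M = windowM la
  c = t * M
  K = 2 * M

  ℓ≤c : length la ≤ c
  ℓ≤c = ≤-trans (≤-trans (m≤m+n (length la) (part la 1)) (m≤m+n _ 1)) (m≤n*m M t)

  λ₁≤c : part la 1 ≤ c
  λ₁≤c = ≤-trans (≤-trans (m≤n+m (part la 1) (length la)) (m≤m+n _ 1)) (m≤n*m M t)

  tK≡c+c : t * K ≡ c + c
  tK≡c+c = trans (cong (λ m → t * (M + m)) (+-identityʳ M)) (*-distribˡ-+ t M M)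

  W : ℕ → Bool
  W = letter t la

  W≡boundary : ∀ p → W p ≡ boundary la c p
  W≡boundary = letter≡boundary t la ℓ≤c

  private
    shape-boundary-la : shape (boundary la c) (c + c) ≡ la × zeros (boundary la c) (c + c) ≡ c
    shape-boundary-la = shape-boundary la ip c ℓ≤c (c + c) (+-monoʳ-≤ c λ₁≤c)

  shape-W : shape W (t * K) ≡ la
  shape-W = trans (shape-cong (t * K) (λ p _ → W≡boundary p)) (trans (cong (shape (boundary la c)) tK≡c+c) (proj₁ shape-boundary-la))

  zeros-W : zeros W (t * K) ≡ c
  zeros-W = trans (count-cong (t * K) (λ p _ → cong not (W≡boundary p))) (trans (cong (zeros (boundary la c)) tK≡c+c) (proj₂ shape-boundary-la))

  quotient : ℕ → List ℕ
  quotient k = shape (residue t W k) K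

  quotientPart≡quotient : ∀ k → quotientPart t la k ≡ quotient k
  quotientPart≡quotient k = decode≡shape (residue t W k) K

  classZeros : ℕ → ℕ
  classZeros k = zeros (residue t W k) K

  classZeros≤K : ∀ k → classZeros k ≤ K
  classZeros≤K k = count≤ K (λ X → not (residue t W k X))

  zerosIn≡classZeros : ∀ k → zerosIn t la k ≡ classZeros k
  zerosIn≡classZeros k = countFalse-map-upTo (residue t W k) K

  coreWord : ℕ → Bool
  coreWord p = sortedWord (zerosIn t la (p % t)) (p / t)

  residue-coreWord : ∀ k → k < t → Sorted (classZeros k) (residue t coreWord k) K
  residue-coreWord k k<t X _ = trans (cong₂ (λ a b → sortedWord (zerosIn t la b) a) (proj₁ (divmod-affine t X k k<t)) (proj₂ (divmod-affine t X k k<t)))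
    (cong (λ m → sortedWord m X) (zerosIn≡classZeros k))

  tcore≡shape : tcore t la ≡ shape coreWord (t * K)
  tcore≡shape = trans (cong decode (concatMap-blocks t (λ q k → sortedWord (zerosIn t la k) q) K)) (decode≡shape coreWord (t * K))

  sameClassZeros : ∀ k → k < t → zeros (residue t coreWord k) K ≡ classZeros k
  sameClassZeros k k<t = zeros-sorted (classZeros k) (residue t coreWord k) K (classZeros≤K k) (residue-coreWord k k<t)

  zeros-coreWord : zeros coreWord (t * K) ≡ c
  zeros-coreWord = trans (zeros-residues t K coreWord) (trans (Σ<-cong t sameClassZeros) (trans (sym (zeros-residues t K W)) zeros-W))

  tcore-isPartition : IsPartition (tcore t la)
  tcore-isPartition = subst IsPartition (sym tcore≡shape) (shape-isPartition coreWord (t * K))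

  quotientPart-isPartition : ∀ k → IsPartition (quotientPart t la k)
  quotientPart-isPartition k = subst IsPartition (sym (quotientPart≡quotient k)) (shape-isPartition (residue t W k) K)

  size-decomposition : size la ≡ size (tcore t la) + t * Σ< t (λ k → size (quotientPart t la k))
  size-decomposition = trans (cong size (sym shape-W)) (trans (size-shape-residues t K W coreWord sameClassZeros
      (λ k k<t → cong size (shape-sorted (classZeros k) (residue t coreWord k) K (residue-coreWord k k<t))))
    (sym (cong₂ (λ a b → size a + t * b) tcore≡shape (Σ<-cong t (λ k _ → cong size (quotientPart≡quotient k))))))

  hooks-divisible : filter (t ∣?_) (hooks la) ↭ map (t *_) (concatMap (λ k → hooks (quotientPart t la k)) (upTo t))
  hooks-divisible = begin
    filter (t ∣?_) (hooks la)                                             ≡⟨ cong (λ l → filter (t ∣?_) (hooks l)) shape-W ⟨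
    filter (t ∣?_) (hooks (shape W (t * K)))                              ≡⟨ cong (filter (t ∣?_)) (hooks-shape W (t * K)) ⟩
    filter (t ∣?_) (wordHooks W (t * K))                                  ↭⟨ filter-∣-wordHooks t W K ⟩
    concatMap (λ k → map (t *_) (wordHooks (residue t W k) K)) (upTo t)   ≡⟨ cong concat (map-cong (λ k → cong (map (t *_)) (quotientHooks k)) (upTo t)) ⟩
    concatMap (λ k → map (t *_) (hooks (quotientPart t la k))) (upTo t)   ≡⟨ map-concatMap (t *_) (λ k → hooks (quotientPart t la k)) (upTo t) ⟨
    map (t *_) (concatMap (λ k → hooks (quotientPart t la k)) (upTo t))   ∎
    where
    open PermutationReasoning
    quotientHooks : ∀ k → wordHooks (residue t W k) K ≡ hooks (quotientPart t la k)
    quotientHooks k = trans (sym (hooks-shape (residue t W k) K)) (cong hooks (sym (quotientPart≡quotient k)))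

  tcore-isTCore : IsTCore t (tcore t la)
  tcore-isTCore = subst (IsTCore t) (sym tcore≡shape) (filter-∣≡[]⇒noneDivisible t (hooks (shape coreWord (t * K))) (↭-empty-inv (begin
    filter (t ∣?_) (hooks (shape coreWord (t * K)))                                ≡⟨ cong (filter (t ∣?_)) (hooks-shape coreWord (t * K)) ⟩
    filter (t ∣?_) (wordHooks coreWord (t * K))                                    ↭⟨ filter-∣-wordHooks t coreWord K ⟩
    concatMap (λ k → map (t *_) (wordHooks (residue t coreWord k) K)) (upTo t)     ≡⟨ cong concat (map-upTo-cong t noClassHooks) ⟩
    concatMap (λ _ → []) (upTo t)                                                  ≡⟨ concat-[] (upTo t) ⟩
    []                                                                             ∎)))
    where
    open PermutationReasoning
    noClassHooks : ∀ k → k < t → map (t *_) (wordHooks (residue t coreWord k) K) ≡ []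
    noClassHooks k k<t = cong (map (t *_)) (wordHooks-sorted (classZeros k) (residue t coreWord k) K (residue-coreWord k k<t))
    concat-[] : ∀ (xs : List ℕ) → concatMap (λ _ → []) xs ≡ ([] {A = ℕ})
    concat-[] [] = refl
    concat-[] (_ ∷ xs) = concat-[] xs

  length-tcore≤c : length (tcore t la) ≤ c
  length-tcore≤c = subst (λ l → length l ≤ c) (sym tcore≡shape) (subst (length (shape coreWord (t * K)) ≤_) zeros-coreWord (length-shape coreWord (t * K)))

  head-tcore≤c : part (tcore t la) 1 ≤ c
  head-tcore≤c = subst (λ l → part l 1 ≤ c) (sym tcore≡shape) (subst (part (shape coreWord (t * K)) 1 ≤_) ones-coreWord (head-shape≤ones coreWord (t * K)))
    where
    ones-coreWord : ones coreWord (t * K) ≡ c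
    ones-coreWord = +-cancelʳ-≡ c _ _ (trans (cong (ones coreWord (t * K) +_) (sym zeros-coreWord)) (trans (ones+zeros coreWord (t * K)) tK≡c+c))

  boundary-tcore : ∀ p → boundary (tcore t la) c p ≡ coreWord p
  boundary-tcore p with p <? t * K
  ... | yes p<tK = trans (cong₂ (λ l m → boundary l m p) tcore≡shape (sym zeros-coreWord)) (boundary-shape coreWord (t * K) p p<tK)
  ... | no p≮tK = trans (boundary-top tcore-isPartition c p (≤-trans (+-monoʳ-≤ c head-tcore≤c) (≤-trans (≤-reflexive (sym tK≡c+c)) (≮⇒≥ p≮tK))))
    (sym (cong not (<ᵇ-false (≤-trans (≤-reflexive (zerosIn≡classZeros (p % t))) (≤-trans (classZeros≤K (p % t)) K≤p/t)))))
    where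
    K≤p/t : K ≤ p / t
    K≤p/t = ≤-trans (≤-reflexive (sym (trans (cong (_/ t) (*-comm t K)) (m*n/n≡m K t)))) (/-monoˡ-≤ t (≮⇒≥ p≮tK))

-- Symmetric words and the sets P_z

-- For h = boundary la c this is equivalent to la ∈ P_z (InP⇒symmetric, symmetric⇒InP).
Symmetric : ℕ → ℕ → (ℕ → Bool) → Set
Symmetric z c h = (∀ x → x < z → h (c + x) ≡ true) ×
  (∀ p q → suc (p + q) ≡ c + c + z → (p < c ⊎ c + z ≤ p) → h p ≡ not (h q))

symmetric-cong : ∀ {z c} {f g : ℕ → Bool} → (∀ p → f p ≡ g p) → Symmetric z c f → Symmetric z c g
symmetric-cong {z} {c} f≗g (ones , reflection) =
  (λ x x<z → trans (sym (f≗g (c + x))) (ones x x<z)) , (λ p q e side → trans (sym (f≗g p)) (trans (reflection p q e side) (cong not (f≗g q))))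

≡not-sym : ∀ {a b} → a ≡ not b → b ≡ not a
≡not-sym {a} {b} e = trans (sym (not-involutive b)) (cong not (sym e))

aboveCentre : ∀ c z {p} → c + z ≤ p → p ≡ c + (p ∸ c) × z ≤ p ∸ c
aboveCentre c z {p} c+z≤p = sym (m+[n∸m]≡n c≤p) , +-cancelˡ-≤ c z (p ∸ c) (subst (c + z ≤_) (sym (m+[n∸m]≡n c≤p)) c+z≤p)
  where
  c≤p : c ≤ p
  c≤p = ≤-trans (m≤m+n c z) c+z≤p

reflection-belowCentre : ∀ c z {p q} → suc (p + q) ≡ c + c + z → p < c → c + z ≤ q
reflection-belowCentre c z {p} {q} e p<c = +-cancelˡ-≤ c (c + z) q (≤-trans (≤-reflexive (trans (sym (+-assoc c c z)) (sym e))) (+-monoˡ-≤ q p<c))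

reflection-index : ∀ c z y q → suc (c + (y + z) + q) ≡ c + c + z → q ≡ c ∸ suc y × y < c
reflection-index c z y q e = q≡ , y<c
  where
  regroup : ∀ c z y q → suc (y + q) + (c + z) ≡ suc (c + (y + z) + q)
  regroup = solve-∀
  y+q<c : suc (y + q) ≡ c
  y+q<c = +-cancelʳ-≡ (c + z) _ _ (trans (regroup c z y q) (trans e (+-assoc c c z)))
  y<c : y < c
  y<c = subst (y <_) y+q<c (s≤s (m≤m+n y q))
  q≡ : q ≡ c ∸ suc y
  q≡ = sym (trans (cong (_∸ suc y) (sym y+q<c)) (m+n∸m≡n y q))

reflection-index⁻¹ : ∀ c z y → y < c → suc (c + (y + z) + (c ∸ suc y)) ≡ c + c + z
reflection-index⁻¹ c z y y<c = trans (regroup c z y (c ∸ suc y)) (cong (λ k → c + k + z) (m∸n+n≡m y<c))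
  where
  regroup : ∀ c z y w → suc (c + (y + z) + w) ≡ c + (w + suc y) + z
  regroup = solve-∀

module _ {la : List ℕ} (ip : IsPartition la) (c z : ℕ) (ℓ≤c : length la ≤ c) (λ₁≤c : part la 1 ≤ c) where

  private
    h : ℕ → Bool
    h = boundary la c

  InP⇒symmetric : InP z la → Symmetric z c h
  InP⇒symmetric inP = onesAtCentre , reflection
    where
    onesAtCentre : ∀ x → x < z → h (c + x) ≡ true
    onesAtCentre x x<z with h (c + x) in hx
    ... | true = refl
    ... | false with boundary-false⇒frobα ip c ℓ≤c x hx
    ... | i , 1≤i , i≤d , x≡α = ⊥-elim (<⇒≱ x<z (subst (z ≤_) (sym (trans x≡α (inP i 1≤i i≤d))) (m≤n+m z _)))
    fromCentre : ∀ x q → z ≤ x → suc (c + x + q) ≡ c + c + z → h (c + x) ≡ not (h q)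
    fromCentre x q z≤x e with reflection-index c z (x ∸ z) q (subst (λ k → suc (c + k + q) ≡ c + c + z) (sym (m∸n+n≡m z≤x)) e)
    ... | q≡ , y<c with h (c + x) in hx
    ...   | false with boundary-false⇒frobα ip c ℓ≤c x hx
    ...     | i , 1≤i , i≤d , x≡α = sym (cong not (trans (cong h q≡) (frobβ⇒boundary-true ip c ℓ≤c λ₁≤c (x ∸ z) y<c (i , 1≤i , i≤d , y≡β))))
      where
      y≡β : x ∸ z ≡ frobβ la i
      y≡β = trans (cong (_∸ z) (trans x≡α (inP i 1≤i i≤d))) (m+n∸n≡m _ z)
    fromCentre x q z≤x e | q≡ , y<c | true with h q in hq
    ...     | false = refl
    ...     | true with boundary-true⇒frobβ ip c ℓ≤c λ₁≤c (x ∸ z) y<c (trans (cong h (sym q≡)) hq)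
    ...       | i , 1≤i , i≤d , y≡β = ⊥-elim (true≢false (trans (sym hx) (frobα⇒boundary-false ip c ℓ≤c x (i , 1≤i , i≤d , x≡α))))
      where
      x≡α : x ≡ frobα la i
      x≡α = trans (sym (m∸n+n≡m z≤x)) (trans (cong (_+ z) y≡β) (sym (inP i 1≤i i≤d)))
    reflection : ∀ p q → suc (p + q) ≡ c + c + z → (p < c ⊎ c + z ≤ p) → h p ≡ not (h q)
    reflection p q e (inj₂ c+z≤p) with aboveCentre c z c+z≤p
    ... | p≡ , z≤x = subst (λ p → h p ≡ not (h q)) (sym p≡) (fromCentre (p ∸ c) q z≤x (subst (λ p → suc (p + q) ≡ c + c + z) p≡ e))
    reflection p q e (inj₁ p<c) with aboveCentre c z (reflection-belowCentre c z e p<c)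
    ... | q≡ , z≤x = ≡not-sym (subst (λ q → h q ≡ not (h p)) (sym q≡)
      (fromCentre (q ∸ c) p z≤x (subst (λ q → suc (q + p) ≡ c + c + z) q≡ (trans (cong suc (+-comm q p)) e))))

  symmetric⇒InP : Symmetric z c h → InP z la
  symmetric⇒InP (onesAtCentre , reflection) =
    strictlyDecreasing-covers⇒≡ (durfee la) (frobα la) (λ i → frobβ la i + z) (frobα-strictlyDecreasing ip) β+z-strict α⊆β+z β+z⊆α
    where
    durfee-conj-la : durfee (conj la) ≡ durfee la
    durfee-conj-la = durfee-conj ip
    β+z-strict : StrictlyDecreasing (durfee la) (λ i → frobβ la i + z)
    β+z-strict i j 1≤i i<j j≤d = +-monoˡ-< z (frobα-strictlyDecreasing (conj-isPartition ip) i j 1≤i i<j (subst (j ≤_) (sym durfee-conj-la) j≤d))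
    β<c : ∀ i → 1 ≤ i → i ≤ durfee la → frobβ la i < c
    β<c i 1≤i i≤d = frobα< (conj-isPartition ip) c (≤-trans (head-conj≤length la) ℓ≤c) i 1≤i (subst (i ≤_) (sym durfee-conj-la) i≤d)
    α⊆β+z : Covers (durfee la) (frobα la) (λ i → frobβ la i + z)
    α⊆β+z i 1≤i i≤d =
      let (k , 1≤k , k≤d , y≡β) = boundary-true⇒frobβ ip c ℓ≤c λ₁≤c y y<c atMirror
      in k , 1≤k , k≤d , trans (sym (m∸n+n≡m z≤x)) (cong (_+ z) y≡β)
      where
      x = frobα la i
      atα : h (c + x) ≡ false
      atα = frobα⇒boundary-false ip c ℓ≤c x (i , 1≤i , i≤d , refl)
      z≤x : z ≤ x
      z≤x with z ≤? x
      ... | yes z≤x = z≤x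
      ... | no z≰x = ⊥-elim (true≢false (trans (sym (onesAtCentre x (≰⇒> z≰x))) atα))
      y = x ∸ z
      y<c : y < c
      y<c = ≤-<-trans (m∸n≤m x z) (frobα< ip c λ₁≤c i 1≤i i≤d)
      e : suc (c + x + (c ∸ suc y)) ≡ c + c + z
      e = subst (λ k → suc (c + k + (c ∸ suc y)) ≡ c + c + z) (m∸n+n≡m z≤x) (reflection-index⁻¹ c z y y<c)
      atMirror : h (c ∸ suc y) ≡ true
      atMirror = trans (≡not-sym (reflection (c + x) (c ∸ suc y) e (inj₂ (+-monoʳ-≤ c z≤x)))) (cong not atα)
    β+z⊆α : Covers (durfee la) (λ i → frobβ la i + z) (frobα la)
    β+z⊆α i 1≤i i≤d = boundary-false⇒frobα ip c ℓ≤c (y + z) atMirror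
      where
      y = frobβ la i
      atβ : h (c ∸ suc y) ≡ true
      atβ = frobβ⇒boundary-true ip c ℓ≤c λ₁≤c y (β<c i 1≤i i≤d) (i , 1≤i , i≤d , refl)
      atMirror : h (c + (y + z)) ≡ false
      atMirror = trans (reflection (c + (y + z)) (c ∸ suc y) (reflection-index⁻¹ c z y (β<c i 1≤i i≤d)) (inj₂ (+-monoʳ-≤ c (m≤n+m z y)))) (cong not atβ)

mirror+suc : ∀ {a r} → r < a → a ∸ r ∸ 1 + suc r ≡ a
mirror+suc {a} {r} r<a = trans (cong (_+ suc r) (trans (∸-+-assoc a r 1) (cong (a ∸_) (+-comm r 1)))) (m∸n+n≡m r<a)

symmetric⇒residue-reflect : ∀ t z M {h} .{{_ : NonZero t}} → Symmetric z (t * M) h → ∀ r → z ≤ r → r < t →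
  ∀ X → X < 2 * M → residue t h r X ≡ reflect (residue t h (t + z ∸ r ∸ 1)) (2 * M) X
symmetric⇒residue-reflect t z M (_ , reflection) r z≤r r<t X X<2M = reflection (t * X + r) (t * Y + s) sumsToCentre side
  where
  s Y : ℕ
  s = t + z ∸ r ∸ 1
  Y = 2 * M ∸ suc X
  regroup : ∀ t X r Y s → suc (t * X + r + (t * Y + s)) + t ≡ t * (Y + suc X) + (s + suc r)
  regroup = solve-∀
  regroup′ : ∀ t M z → t * (2 * M) + (t + z) ≡ t * M + t * M + z + t
  regroup′ = solve-∀
  sumsToCentre : suc (t * X + r + (t * Y + s)) ≡ t * M + t * M + z
  sumsToCentre = +-cancelʳ-≡ t _ _ (trans (regroup t X r Y s)
    (trans (cong₂ (λ a b → t * a + b) (m∸n+n≡m X<2M) (mirror+suc (≤-trans r<t (m≤m+n t z)))) (regroup′ t M z)))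
  side : (t * X + r < t * M) ⊎ (t * M + z ≤ t * X + r)
  side with X <? M
  ... | yes X<M = inj₁ (t*+<t* t r<t X<M)
  ... | no X≮M = inj₂ (+-mono-≤ (*-monoʳ-≤ t (≮⇒≥ X≮M)) z≤r)

sortedWord-flip : ∀ a b X Y → suc (X + Y) ≡ a + b → sortedWord a X ≡ not (sortedWord b Y)
sortedWord-flip a b X Y e with X <? a
... | yes X<a = trans (cong not (<ᵇ-true X<a)) (cong (λ β → not (not β)) (sym (<ᵇ-false b≤Y)))
  where
  b≤Y : b ≤ Y
  b≤Y = +-cancelˡ-≤ a b Y (≤-trans (≤-reflexive (sym e)) (+-monoˡ-≤ Y X<a))
... | no X≮a = trans (cong not (<ᵇ-false (≮⇒≥ X≮a))) (cong (λ β → not (not β)) (sym (<ᵇ-true Y<b)))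
  where
  Y<b : Y < b
  Y<b = +-cancelˡ-< a Y b (≤-trans (≤-reflexive (sym (+-suc a Y))) (≤-trans (+-monoˡ-≤ (suc Y) (≮⇒≥ X≮a)) (≤-reflexive (trans (+-suc X Y) e))))

sortedWord-flip-centre : ∀ M X Y → X + Y ≡ M + M → X < M ⊎ M < X → sortedWord M X ≡ not (sortedWord M Y)
sortedWord-flip-centre M X Y e (inj₁ X<M) = trans (cong not (<ᵇ-true X<M)) (cong (λ β → not (not β)) (sym (<ᵇ-false (<⇒≤ M<Y))))
  where
  M<Y : M < Y
  M<Y = +-cancelˡ-< M M Y (≤-trans (≤-reflexive (cong suc (sym e))) (+-monoˡ-≤ Y X<M))
sortedWord-flip-centre M X Y e (inj₂ M<X) = trans (cong not (<ᵇ-false (<⇒≤ M<X))) (cong (λ β → not (not β)) (sym (<ᵇ-true Y<M)))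
  where
  Y<M : Y < M
  Y<M = +-cancelˡ-< X Y M (≤-trans (≤-reflexive (cong suc e)) (+-monoˡ-≤ M M<X))

-- The word of a t-core has this form: in every residue class all letters 0 come first.
module _ (t z M : ℕ) .{{_ : NonZero t}} (z<t : z < t) (n : ℕ → ℕ) (low : ∀ r → r < z → n r ≡ M)
         (paired : ∀ r → z ≤ r → r < t → n r + n (t + z ∸ r ∸ 1) ≡ 2 * M) where

  Reflected : ℕ → ℕ → ℕ → ℕ → Set
  Reflected X r Y s = t * (X + Y) + suc (r + s) ≡ t * (2 * M) + z

  reflected : ∀ p q → suc (p + q) ≡ t * M + t * M + z → Reflected (p / t) (p % t) (q / t) (q % t)
  reflected p q e = trans (regroup t (p / t) (q / t) (p % t) (q % t))
    (trans (cong₂ (λ a b → suc (a + b)) (sym (≡t*[m/t]+m%t t p)) (sym (≡t*[m/t]+m%t t q))) (trans e (regroup′ t M z)))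
    where
    regroup : ∀ t X Y r s → t * (X + Y) + suc (r + s) ≡ suc (t * X + r + (t * Y + s))
    regroup = solve-∀
    regroup′ : ∀ t M z → t * M + t * M + z ≡ t * (2 * M) + z
    regroup′ = solve-∀

  sortedClasses-reflect-low : ∀ X r Y s → Reflected X r Y s → suc (r + s) < t →
    (t * X + r < t * M ⊎ t * M + z ≤ t * X + r) → sortedWord (n r) X ≡ not (sortedWord (n s) Y)
  sortedClasses-reflect-low X r Y s e noCarry side =
    subst₂ (λ a b → sortedWord a X ≡ not (sortedWord b Y)) (sym (low r r<z)) (sym (low s s<z))
      (sortedWord-flip-centre M X Y (trans (proj₁ split) (cong (M +_) (+-identityʳ M))) (centreSide side))
    where
    split : X + Y ≡ 2 * M × suc (r + s) ≡ z
    split = t*+-injective t (X + Y) (2 * M) (suc (r + s)) z e noCarry z<t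
    r<z : r < z
    r<z = subst (r <_) (proj₂ split) (s≤s (m≤m+n r s))
    s<z : s < z
    s<z = subst (s <_) (proj₂ split) (s≤s (m≤n+m s r))
    centreSide : (t * X + r < t * M ⊎ t * M + z ≤ t * X + r) → X < M ⊎ M < X
    centreSide (inj₁ p<c) = inj₁ (t*+<t*⁻¹ t p<c)
    centreSide (inj₂ c+z≤p) = inj₂ (t*+≥t*+⁻¹ t r<z c+z≤p)

  sortedClasses-reflect-paired : ∀ X r Y s → Reflected X r Y s → r < t → s < t → t ≤ suc (r + s) →
    sortedWord (n r) X ≡ not (sortedWord (n s) Y)
  sortedClasses-reflect-paired X r Y s e r<t s<t carry =
    sortedWord-flip (n r) (n s) X Y (trans (proj₁ split) (sym (subst (λ u → n r + n u ≡ 2 * M) (sym s≡) (paired r z≤r r<t))))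
    where
    w = suc (r + s) ∸ t
    w<t : w < t
    w<t = +-cancelʳ-< t w t (subst (λ v → suc v ≤ t + t) (sym (m∸n+n≡m carry)) (≤-trans (≤-reflexive (cong suc (sym (+-suc r s)))) (+-mono-≤ r<t s<t)))
    regroup : ∀ t a w → t * suc a + w ≡ t * a + (w + t)
    regroup = solve-∀
    split : suc (X + Y) ≡ 2 * M × w ≡ z
    split = t*+-injective t (suc (X + Y)) (2 * M) w z (trans (regroup t (X + Y) w) (trans (cong (t * (X + Y) +_) (m∸n+n≡m carry)) e)) w<t z<t
    r+s≡ : suc (r + s) ≡ t + z
    r+s≡ = trans (sym (m∸n+n≡m carry)) (trans (cong (_+ t) (proj₂ split)) (+-comm z t))
    z≤r : z ≤ r
    z≤r = +-cancelʳ-≤ t z r (≤-trans (≤-reflexive (+-comm z t)) (≤-trans (≤-reflexive (sym r+s≡)) (≤-trans (≤-reflexive (sym (+-suc r s))) (+-monoʳ-≤ r s<t))))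
    s≡ : s ≡ t + z ∸ r ∸ 1
    s≡ = sym (trans (cong (λ v → v ∸ r ∸ 1) (trans (sym r+s≡) (sym (+-suc r s)))) (cong (_∸ 1) (m+n∸m≡n r (suc s))))

  sortedClasses-symmetric : Symmetric z (t * M) (λ p → sortedWord (n (p % t)) (p / t))
  sortedClasses-symmetric = onesAtCentre , reflection
    where
    onesAtCentre : ∀ x → x < z → sortedWord (n ((t * M + x) % t)) ((t * M + x) / t) ≡ true
    onesAtCentre x x<z = trans (cong₂ (λ a b → sortedWord (n b) a) (proj₁ (divmod-affine t M x x<t)) (proj₂ (divmod-affine t M x x<t)))
      (trans (cong (λ m → sortedWord m M) (low x x<z)) (cong not (<ᵇ-false (≤-refl {M}))))
      where x<t = <-trans x<z z<t
    reflection : ∀ p q → suc (p + q) ≡ t * M + t * M + z → (p < t * M ⊎ t * M + z ≤ p) →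
      sortedWord (n (p % t)) (p / t) ≡ not (sortedWord (n (q % t)) (q / t))
    reflection p q e side with suc (p % t + q % t) <? t
    ... | yes noCarry = sortedClasses-reflect-low (p / t) (p % t) (q / t) (q % t) (reflected p q e) noCarry
      (⊎-map (subst (_< t * M) (≡t*[m/t]+m%t t p)) (subst (t * M + z ≤_) (≡t*[m/t]+m%t t p)) side)
    ... | no carry = sortedClasses-reflect-paired (p / t) (p % t) (q / t) (q % t) (reflected p q e) (m%n<n p t) (m%n<n q t) (≮⇒≥ carry)

-- Partitions in BG_{z,t}

even⊎odd : ∀ n → Σ ℕ λ j → n ≡ j + j ⊎ n ≡ suc (j + j)
even⊎odd zero = 0 , inj₁ refl
even⊎odd (suc n) with even⊎odd n
... | j , inj₁ n≡j+j = j , inj₂ (cong suc n≡j+j)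
... | j , inj₂ n≡1+j+j = suc j , inj₁ (cong suc (trans n≡1+j+j (sym (+-suc j j))))

⌊n+n/2⌋≡n : ∀ n → ⌊ n + n /2⌋ ≡ n
⌊n+n/2⌋≡n zero = refl
⌊n+n/2⌋≡n (suc n) = trans (cong (λ m → ⌊ suc m /2⌋) (+-suc n n)) (cong suc (⌊n+n/2⌋≡n n))

⌊1+n+n/2⌋≡n : ∀ n → ⌊ suc (n + n) /2⌋ ≡ n
⌊1+n+n/2⌋≡n zero = refl
⌊1+n+n/2⌋≡n (suc n) = trans (cong (λ m → ⌊ suc (suc m) /2⌋) (+-suc n n)) (cong suc (⌊1+n+n/2⌋≡n n))

∸-mirror : ∀ {a b c} → a ≡ b + suc c → a ∸ b ∸ 1 ≡ c
∸-mirror {b = b} {c} refl = cong (_∸ 1) (m+n∸m≡n b (suc c))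

palindrome-sum : ∀ n (u : ℕ → ℕ) → (∀ i → i < n → u (n + i) ≡ u (n ∸ suc i)) → Σ< (n + n) u ≡ 2 * Σ< n u
palindrome-sum n u pal = begin
  Σ< (n + n) u                      ≡⟨ Σ<-split n n u ⟩
  Σ< n u + Σ< n (λ i → u (n + i))   ≡⟨ cong (Σ< n u +_) (trans (Σ<-cong n pal) (Σ<-rev n u)) ⟩
  Σ< n u + Σ< n u                   ≡⟨ cong (Σ< n u +_) (+-identityʳ _) ⟨
  2 * Σ< n u                        ∎
  where open ≡-Reasoning

palindrome-sum-odd : ∀ n (u : ℕ → ℕ) → u n ≡ 0 → (∀ i → i < n → u (suc n + i) ≡ u (n ∸ suc i)) → Σ< (n + suc n) u ≡ 2 * Σ< n u
palindrome-sum-odd n u middle pal = begin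
  Σ< (n + suc n) u                                    ≡⟨ Σ<-split n (suc n) u ⟩
  Σ< n u + Σ< (suc n) (λ i → u (n + i))               ≡⟨ cong (Σ< n u +_) (Σ<-cons n (λ i → u (n + i))) ⟩
  Σ< n u + (u (n + 0) + Σ< n (λ i → u (n + suc i)))   ≡⟨ cong (λ m → Σ< n u + (m + Σ< n (λ i → u (n + suc i)))) (trans (cong u (+-identityʳ n)) middle) ⟩
  Σ< n u + Σ< n (λ i → u (n + suc i))                 ≡⟨ cong (Σ< n u +_) (trans (Σ<-cong n (λ i i<n → trans (cong u (+-suc n i)) (pal i i<n))) (Σ<-rev n u)) ⟩
  Σ< n u + Σ< n u                                     ≡⟨ cong (Σ< n u +_) (+-identityʳ _) ⟨
  2 * Σ< n u                                          ∎
  where open ≡-Reasoning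

sum-range-prefix : ∀ (s : ℕ → ℕ) z j {b} → b ≡ z + j → sum (map s (range z b)) ≡ Σ< j (λ i → s (z + i))
sum-range-prefix s z j refl = trans (sum-map-range s z (z + j)) (cong (λ n → Σ< n (λ i → s (z + i))) (m+n∸m≡n z j))

suc⌊n+n∸2/2⌋ : ∀ n → 1 ≤ n → suc ⌊ n + n ∸ 2 /2⌋ ≡ n
suc⌊n+n∸2/2⌋ (suc n) _ = cong suc (trans (cong ⌊_/2⌋ (cong (_∸ 1) (+-suc n n))) (⌊n+n/2⌋≡n n))

suc⌊1+n+n∸2/2⌋ : ∀ n → 1 ≤ n → suc ⌊ suc (n + n) ∸ 2 /2⌋ ≡ n
suc⌊1+n+n∸2/2⌋ (suc n) _ = cong suc (trans (cong ⌊_/2⌋ (+-suc n n)) (⌊1+n+n/2⌋≡n n))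

sumClasses-even : ∀ z j (s : ℕ → ℕ) → (∀ r → r < z → s r ≡ 0) →
  (∀ r → z ≤ r → r < z + (j + j) → s r ≡ s (z + (j + j) + z ∸ r ∸ 1)) → Σ< (z + (j + j)) s ≡ 2 * Σ< j (λ i → s (z + i))
sumClasses-even z j s low paired = begin
  Σ< (z + (j + j)) s            ≡⟨ Σ<-split z (j + j) s ⟩
  Σ< z s + Σ< (j + j) u         ≡⟨ cong (_+ Σ< (j + j) u) (Σ<-zero z low) ⟩
  Σ< (j + j) u                  ≡⟨ palindrome-sum j u pal ⟩
  2 * Σ< j u                    ∎
  where
  open ≡-Reasoning
  u : ℕ → ℕ
  u i = s (z + i)
  identity : ∀ z k i → z + ((k + suc i) + (k + suc i)) + z ≡ z + ((k + suc i) + i) + suc (z + k)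
  identity = solve-∀
  mirror : ∀ {i} → i < j → z + (j + j) + z ≡ z + (j + i) + suc (z + (j ∸ suc i))
  mirror {i} i<j = subst (λ x → z + (x + x) + z ≡ z + (x + i) + suc (z + (j ∸ suc i))) (m∸n+n≡m i<j) (identity z (j ∸ suc i) i)
  pal : ∀ i → i < j → u (j + i) ≡ u (j ∸ suc i)
  pal i i<j = trans (paired (z + (j + i)) (m≤m+n z _) (+-monoʳ-< z (+-monoʳ-< j i<j))) (cong s (∸-mirror (mirror i<j)))

sumClasses-odd : ∀ z j (s : ℕ → ℕ) → (∀ r → r < z → s r ≡ 0) → s (z + j) ≡ 0 →
  (∀ r → z ≤ r → r < z + suc (j + j) → s r ≡ s (z + suc (j + j) + z ∸ r ∸ 1)) → Σ< (z + suc (j + j)) s ≡ 2 * Σ< j (λ i → s (z + i))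
sumClasses-odd z j s low middle paired = begin
  Σ< (z + suc (j + j)) s        ≡⟨ Σ<-split z (suc (j + j)) s ⟩
  Σ< z s + Σ< (suc (j + j)) u   ≡⟨ cong (_+ Σ< (suc (j + j)) u) (Σ<-zero z low) ⟩
  Σ< (suc (j + j)) u            ≡⟨ cong (λ n → Σ< n u) (+-suc j j) ⟨
  Σ< (j + suc j) u              ≡⟨ palindrome-sum-odd j u middle pal ⟩
  2 * Σ< j u                    ∎
  where
  open ≡-Reasoning
  u : ℕ → ℕ
  u i = s (z + i)
  identity : ∀ z k i → z + suc ((k + suc i) + (k + suc i)) + z ≡ z + (suc (k + suc i) + i) + suc (z + k)
  identity = solve-∀
  mirror : ∀ {i} → i < j → z + suc (j + j) + z ≡ z + (suc j + i) + suc (z + (j ∸ suc i))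
  mirror {i} i<j = subst (λ x → z + suc (x + x) + z ≡ z + (suc x + i) + suc (z + (j ∸ suc i))) (m∸n+n≡m i<j) (identity z (j ∸ suc i) i)
  pal : ∀ i → i < j → u (suc j + i) ≡ u (j ∸ suc i)
  pal i i<j = trans (paired (z + (suc j + i)) (m≤m+n z _) (+-monoʳ-< z (s≤s (+-monoʳ-< j i<j)))) (cong s (∸-mirror (mirror i<j)))

-- r ↦ t + z ∸ r ∸ 1 pairs off the classes z, …, t ∸ 1; the first half of them ends at ⌊(t + z ∸ 2)/2⌋.
sum-pairedClasses : ∀ t z (s : ℕ → ℕ) → 2 ≤ t → z < t →
  (∀ r → r < z → s r ≡ 0) → (∀ m → t + z ∸ 1 ≡ 2 * m → s m ≡ 0) → (∀ r → z ≤ r → r < t → s r ≡ s (t + z ∸ r ∸ 1)) →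
  Σ< t s ≡ 2 * sum (map s (range z (suc ⌊ t + z ∸ 2 /2⌋)))
sum-pairedClasses t z s 2≤t z<t low middle paired with t ∸ z | m+[n∸m]≡n (<⇒≤ z<t) | even⊎odd (t ∸ z)
... | _ | refl | j , inj₁ refl = trans (sumClasses-even z j s low paired) (cong (2 *_) (sym (sum-range-prefix s z j top)))
  where
  double : ∀ z j → z + (j + j) + z ≡ (z + j) + (z + j)
  double = solve-∀
  1≤z+j : ∀ z j → 2 ≤ z + (j + j) → 1 ≤ z + j
  1≤z+j (suc z) j _ = s≤s z≤n
  1≤z+j zero (suc j) _ = s≤s z≤n
  top : suc ⌊ z + (j + j) + z ∸ 2 /2⌋ ≡ z + j
  top = trans (cong (λ n → suc ⌊ n ∸ 2 /2⌋) (double z j)) (suc⌊n+n∸2/2⌋ (z + j) (1≤z+j z j 2≤t))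
... | _ | refl | j , inj₂ refl = trans (sumClasses-odd z j s low (middle (z + j) (cong (_∸ 1) (double z j))) paired)
  (cong (2 *_) (sym (sum-range-prefix s z j top)))
  where
  double : ∀ z j → z + suc (j + j) + z ≡ suc (2 * (z + j))
  double = solve-∀
  1≤z+j : ∀ z j → 2 ≤ z + suc (j + j) → 1 ≤ z + j
  1≤z+j (suc z) j _ = s≤s z≤n
  1≤z+j zero (suc j) _ = s≤s z≤n
  1≤z+j zero zero (s≤s ())
  top : suc ⌊ z + suc (j + j) + z ∸ 2 /2⌋ ≡ z + j
  top = trans (cong (λ n → suc ⌊ n ∸ 2 /2⌋) (trans (double z j) (cong suc (cong (z + j +_) (+-identityʳ (z + j))))))
    (suc⌊1+n+n∸2/2⌋ (z + j) (1≤z+j z j 2≤t))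

module BGDecomposition (t z : ℕ) .{{_ : NonZero t}} (z<t : z < t) {la : List ℕ} (bg : InBG z t la) where

  open LittlewoodDecomposition t (proj₁ bg)

  private
    ip : IsPartition la
    ip = proj₁ bg
    inP : InP z la
    inP = proj₁ (proj₂ bg)
    avoids : ∀ j → 1 ≤ j → j ≤ durfee la → (∀ k → 1 ≤ k → k ≤ z → ¬ (t ∣ (frobβ la j + k))) × ¬ (Σ ℕ λ m → 2 * frobβ la j + z + 1 ≡ t * (2 * m + 1))
    avoids = proj₂ (proj₂ bg)

  symmetric-W : Symmetric z c W
  symmetric-W = symmetric-cong (λ p → sym (W≡boundary p)) (InP⇒symmetric ip c z ℓ≤c λ₁≤c inP)

  quotient-conj : ∀ r → z ≤ r → r < t → quotient r ≡ conj (quotient (t + z ∸ r ∸ 1))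
  quotient-conj r z≤r r<t =
    trans (shape-cong K (symmetric⇒residue-reflect t z M symmetric-W r z≤r r<t)) (shape-reflect (residue t W (t + z ∸ r ∸ 1)) K)

  classZeros-paired : ∀ r → z ≤ r → r < t → classZeros r + classZeros (t + z ∸ r ∸ 1) ≡ K
  classZeros-paired r z≤r r<t = trans (cong (_+ classZeros s) zeros≡ones) (ones+zeros (residue t W s) K)
    where
    s = t + z ∸ r ∸ 1
    zeros≡ones : classZeros r ≡ ones (residue t W s) K
    zeros≡ones = trans (count-cong K (λ X X<K → cong not (symmetric⇒residue-reflect t z M symmetric-W r z≤r r<t X X<K)))
      (zeros-reflect (residue t W s) K)

  zeroAbove : ∀ δ r → W (t * (M + δ) + r) ≡ false → Σ ℕ λ i → 1 ≤ i × i ≤ durfee la × t * δ + r ≡ frobβ la i + z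
  zeroAbove δ r e =
    let (i , 1≤i , i≤d , x≡α) = boundary-false⇒frobα ip c ℓ≤c (t * δ + r) (trans (cong (boundary la c) (regroup t M δ r)) (trans (sym (W≡boundary _)) e))
    in i , 1≤i , i≤d , trans x≡α (inP i 1≤i i≤d)
    where
    regroup : ∀ t M δ r → t * M + (t * δ + r) ≡ t * (M + δ) + r
    regroup = solve-∀

  oneBelow : ∀ X r → t * X + r < c → W (t * X + r) ≡ true → Σ ℕ λ i → 1 ≤ i × i ≤ durfee la × t * X + r + suc (frobβ la i) ≡ c
  oneBelow X r p<c e =
    let (i , 1≤i , i≤d , y≡β) = boundary-true⇒frobβ ip c ℓ≤c λ₁≤c (c ∸ suc p) (∸-monoʳ-< {c} {suc p} {0} z<s p<c)
                                  (trans (cong (boundary la c) mirrored) (trans (sym (W≡boundary p)) e))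
    in i , 1≤i , i≤d , trans (cong (λ y → p + suc y) (sym y≡β)) (trans (+-suc p _) (m+[n∸m]≡n p<c))
    where
    p = t * X + r
    mirrored : c ∸ suc (c ∸ suc p) ≡ p
    mirrored = trans (cong (_∸ suc (c ∸ suc p)) (trans (sym (m∸n+n≡m p<c)) (+-suc (c ∸ suc p) p))) (m+n∸m≡n (suc (c ∸ suc p)) p)

  -- A residue class meeting neither a position c + α_i nor a position c ∸ 1 ∸ β_i is sorted.
  sorted-class : ∀ r → r < t →
    (∀ δ i → 1 ≤ i → i ≤ durfee la → t * δ + r ≡ frobβ la i + z → ⊥) →
    (∀ X δ i → 1 ≤ i → i ≤ durfee la → t * X + r + suc (frobβ la i) ≡ t * (X + suc δ) → ⊥) →
    Sorted M (residue t W r) K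
  sorted-class r r<t noZero noOne X X<K with X <? M
  ... | no X≮M = trans (cong (λ y → W (t * y + r)) (sym (m+[n∸m]≡n (≮⇒≥ X≮M)))) (trans isOne (cong not (sym (<ᵇ-false (≮⇒≥ X≮M)))))
    where
    isOne : W (t * (M + (X ∸ M)) + r) ≡ true
    isOne with W (t * (M + (X ∸ M)) + r) in e
    ... | true = refl
    ... | false = let (i , 1≤i , i≤d , eq) = zeroAbove (X ∸ M) r e in ⊥-elim (noZero (X ∸ M) i 1≤i i≤d eq)
  ... | yes X<M = trans isZero (cong not (sym (<ᵇ-true X<M)))
    where
    isZero : W (t * X + r) ≡ false
    isZero with W (t * X + r) in e
    ... | false = refl
    ... | true = let (i , 1≤i , i≤d , eq) = oneBelow X r (t*+<t* t r<t X<M) e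
                 in ⊥-elim (noOne X (M ∸ suc X) i 1≤i i≤d (trans eq (cong (t *_) (sym (trans (+-suc X (M ∸ suc X)) (m+[n∸m]≡n X<M))))))

  sorted-low : ∀ r → r < z → Sorted M (residue t W r) K
  sorted-low r r<z = sorted-class r (<-trans r<z z<t)
    (λ δ i 1≤i i≤d e → proj₁ (avoids i 1≤i i≤d) (z ∸ r) (m<n⇒0<n∸m r<z) (m∸n≤m z r) (divides δ (above δ (frobβ la i) e)))
    (λ X δ i 1≤i i≤d e → proj₁ (avoids i 1≤i i≤d) (suc r) (s≤s z≤n) r<z (divides (suc δ) (below X δ (frobβ la i) e)))
    where
    above : ∀ δ β → t * δ + r ≡ β + z → β + (z ∸ r) ≡ δ * t
    above δ β e = sym (trans (*-comm δ t) (+-cancelʳ-≡ r _ _ (trans e (trans (cong (β +_) (sym (m∸n+n≡m (<⇒≤ r<z)))) (sym (+-assoc β (z ∸ r) r))))))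
    below : ∀ X δ β → t * X + r + suc β ≡ t * (X + suc δ) → β + suc r ≡ suc δ * t
    below X δ β e = trans (trans (+-suc β r) (trans (cong suc (+-comm β r)) (sym (+-suc r β))))
      (trans (+-cancelˡ-≡ (t * X) _ _ (trans (sym (+-assoc (t * X) r (suc β))) (trans e (*-distribˡ-+ t X (suc δ))))) (*-comm t (suc δ)))

  sorted-middle : ∀ m → t + z ∸ 1 ≡ 2 * m → Sorted M (residue t W m) K
  sorted-middle m t+z∸1≡2m = sorted-class m m<t
    (λ δ i 1≤i i≤d e → proj₂ (avoids i 1≤i i≤d) (δ , above δ (frobβ la i) e))
    (λ X δ i 1≤i i≤d e → proj₂ (avoids i 1≤i i≤d) (δ , below X δ (frobβ la i) e))
    where
    1+2m≡ : suc (2 * m) ≡ t + z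
    1+2m≡ = trans (cong suc (sym t+z∸1≡2m)) (m+[n∸m]≡n {1} {t + z} (≤-trans (>-nonZero⁻¹ t) (m≤m+n t z)))
    m<t : m < t
    m<t = *-cancelˡ-< 2 m t (≤-trans (≤-reflexive 1+2m≡) (≤-trans (+-monoʳ-≤ t (<⇒≤ z<t)) (≤-reflexive (cong (t +_) (sym (+-identityʳ t))))))
    above : ∀ δ β → t * δ + m ≡ β + z → 2 * β + z + 1 ≡ t * (2 * δ + 1)
    above δ β e = +-cancelʳ-≡ z _ _ (trans (regroup₁ β z) (trans (cong (λ x → 2 * x + 1) (sym e))
      (trans (regroup₂ t δ m) (trans (cong (2 * (t * δ) +_) 1+2m≡) (regroup₃ t δ z)))))
      where
      regroup₁ : ∀ β z → 2 * β + z + 1 + z ≡ 2 * (β + z) + 1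
      regroup₁ = solve-∀
      regroup₂ : ∀ t δ m → 2 * (t * δ + m) + 1 ≡ 2 * (t * δ) + suc (2 * m)
      regroup₂ = solve-∀
      regroup₃ : ∀ t δ z → 2 * (t * δ) + (t + z) ≡ t * (2 * δ + 1) + z
      regroup₃ = solve-∀
    below : ∀ X δ β → t * X + m + suc β ≡ t * (X + suc δ) → 2 * β + z + 1 ≡ t * (2 * δ + 1)
    below X δ β e = +-cancelʳ-≡ t _ _ (+-cancelʳ-≡ z _ _ (trans (regroup₁ β z t) (trans (cong (λ x → 2 * β + z + 1 + x) (sym 1+2m≡))
      (trans (regroup₂ β z m) (trans (cong (λ x → 2 * x + z) m+1+β≡) (regroup₃ t δ z))))))
      where
      m+1+β≡ : m + suc β ≡ t * suc δ
      m+1+β≡ = +-cancelˡ-≡ (t * X) _ _ (trans (sym (+-assoc (t * X) m (suc β))) (trans e (*-distribˡ-+ t X (suc δ))))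
      regroup₁ : ∀ β z t → 2 * β + z + 1 + t + z ≡ 2 * β + z + 1 + (t + z)
      regroup₁ = solve-∀
      regroup₂ : ∀ β z m → 2 * β + z + 1 + suc (2 * m) ≡ 2 * (m + suc β) + z
      regroup₂ = solve-∀
      regroup₃ : ∀ t δ z → 2 * (t * suc δ) + z ≡ t * (2 * δ + 1) + t + z
      regroup₃ = solve-∀

  quotientPart-low : ∀ r → r < z → quotientPart t la r ≡ []
  quotientPart-low r r<z = trans (quotientPart≡quotient r) (shape-sorted M (residue t W r) K (sorted-low r r<z))

  quotientPart-middle : ∀ m → t + z ∸ 1 ≡ 2 * m → quotientPart t la m ≡ []
  quotientPart-middle m e = trans (quotientPart≡quotient m) (shape-sorted M (residue t W m) K (sorted-middle m e))

  quotientPart-conj : ∀ r → z ≤ r → r < t → quotientPart t la r ≡ conj (quotientPart t la (t + z ∸ r ∸ 1))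
  quotientPart-conj r z≤r r<t = trans (quotientPart≡quotient r) (trans (quotient-conj r z≤r r<t) (cong conj (sym (quotientPart≡quotient _))))

  tcore-InP : InP z (tcore t la)
  tcore-InP = symmetric⇒InP tcore-isPartition c z length-tcore≤c head-tcore≤c
    (symmetric-cong (λ p → trans (cong (λ m → sortedWord m (p / t)) (sym (zerosIn≡classZeros (p % t)))) (sym (boundary-tcore p)))
      (sortedClasses-symmetric t z M z<t classZeros classZeros-low classZeros-paired))
    where
    classZeros-low : ∀ r → r < z → classZeros r ≡ M
    classZeros-low r r<z = zeros-sorted M (residue t W r) K (m≤m+n M (M + 0)) (sorted-low r r<z)

proposition3p5 : (t z : ℕ) → 2 ≤ t → z ≤ t ∸ 1 → (la : List ℕ) → InBG z t la →
  -- (BG1)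
  (IsTCore t (tcore t la) × IsPartition (tcore t la) × InP z (tcore t la)
    × (∀ k → k < t → IsPartition (quotientPart t la k)))
  -- (BG2)
  × (∀ r → z ≤ r → r < t →
       quotientPart t la r ≡ conj (quotientPart t la (t + z ∸ r ∸ 1)))
  -- (BG'2)
  × ((∀ r → r < z → quotientPart t la r ≡ [])
     × (∀ m → t + z ∸ 1 ≡ 2 * m → quotientPart t la m ≡ []))
  -- (BG3)
  × (size la ≡ size (tcore t la)
       + 2 * t * sum (map (λ r → size (quotientPart t la r))
                          (range z (suc ⌊ t + z ∸ 2 /2⌋))))
  -- (BG4)
  × (filter (t ∣?_) (hooks la)
       ↭ map (t *_) (concatMap (λ k → hooks (quotientPart t la k)) (upTo t)))
proposition3p5 t@(suc _) z 2≤t z≤t∸1 la bg =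
    (tcore-isTCore , tcore-isPartition , tcore-InP , (λ k _ → quotientPart-isPartition k))
  , quotientPart-conj
  , (quotientPart-low , quotientPart-middle)
  , sizes
  , hooks-divisible
  where
  z<t : z < t
  z<t = s≤s z≤t∸1
  open LittlewoodDecomposition t (proj₁ bg)
  open BGDecomposition t z z<t bg
  quotientSize : ℕ → ℕ
  quotientSize r = size (quotientPart t la r)
  halves : Σ< t quotientSize ≡ 2 * sum (map quotientSize (range z (suc ⌊ t + z ∸ 2 /2⌋)))
  halves = sum-pairedClasses t z quotientSize 2≤t z<t
    (λ r r<z → cong size (quotientPart-low r r<z))
    (λ m t+z∸1≡2m → cong size (quotientPart-middle m t+z∸1≡2m))
    (λ r z≤r r<t → trans (cong size (quotientPart-conj r z≤r r<t)) (size-conj (proj₁ (quotientPart-isPartition _))))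
  sizes : size la ≡ size (tcore t la) + 2 * t * sum (map quotientSize (range z (suc ⌊ t + z ∸ 2 /2⌋)))
  sizes = trans size-decomposition (cong (size (tcore t la) +_) (trans (cong (t *_) halves) (regroup t _)))
    where
    regroup : ∀ t s → t * (2 * s) ≡ 2 * t * s
    regroup = solve-∀
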